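{- Let $m\ge2$, $n\ge1$. The flag-major index is a Mahonian statistic on $G(m,1,n)$ with respect to the length function $L$; that is, $fmaj$ and $L$ are equidistributed on $G(m,1,n)$: \[ \sum_{w\in G(m,1,n)}q^{fmaj(w)}=\sum_{w\in G(m,1,n)}q^{L(w)}\quad\Bigl(=\prod_{i=1}^n\tfrac{1-q^{im}}{1-q}\Bigr). \]
   Context: Let $\varepsilon=e^{2\pi i/m}$ and $e_1,\dots,e_n$ the standard basis of $\mathbb C^n$. $G(m,1,n)$ consists of the bijections $w$ of $\{\varepsilon^k i:1\le i\le n,1\le k\le m\}$ with $w(\varepsilon^k i)=\varepsilon^k w(i)$; products are composed right to left. Writing $w(j)=\varepsilon^{r_j}\beta_j$ ($\beta\in S_n$, $0\le r_j\le m-1$), $w$ acts linearly on $\mathbb C^n$ by $w(e_j)=\varepsilon^{r_j}e_{\beta_j}$. Let $t_1$ be the element with $t_1(1)=\varepsilon\cdot 1$ fixing $2,\dots,n$, and $s_i$ ($1\le i\le n-1$) the element swapping $i$ and $i+1$ and fixing the others. Put $\sigma_0=t_1$ and $\sigma_i=s_is_{i-1}\cdots s_1t_1$ for $1\le i\le n-1$. Every $w\in G(m,1,n)$ has a unique expression $w=\sigma_{n-1}^{k_{n-1}}\cdots\sigma_1^{k_1}\sigma_0^{k_0}$ with $0\le k_i\le mi+m-1$, and the flag-major index is $fmaj(w)=\sum_{i=0}^{n-1}k_i$. Let $\Phi=\{\varepsilon^i e_j-\varepsilon^k e_l : \varepsilon^i e_j\ne\varepsilon^k e_l,\ 0\le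 i,k\le m-1,\ 1\le j,l\le n\}$, $\Phi^+=\{\varepsilon^i e_j-\varepsilon^k e_j\in\Phi : 0\le i<k\le m-1\}\cup\{e_j-\varepsilon^k e_l\in\Phi: 0\le k\le m-1,\ 1\le l<j\le n\}\cup\{\varepsilon^i e_j-\varepsilon^k e_l\in\Phi: 0\le i,k\le m-1,\ k\ne 0,\ 1\le j<l\le n\}$, $\Phi^-=\Phi\setminus\Phi^+$, $\Delta=\{e_j-\varepsilon^k e_l\in\Phi : 0\le k\le m-1,\ 1\le l\le j\le n\}$, and $L(w)=|w(\Delta)\cap\Phi^-|$. -}

module Defs where

open import Data.Nat using (ℕ; zero; suc; _+_; _*_; _∸_; _<_; _≤_; _≟_; _<?_; _%_; _/_)
open import Data.Nat.ListAction using (sum)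
open import Data.Nat.Properties using () renaming (_≟_ to _≟ℕ_)
open import Data.Bool using (Bool; true; false; _∧_; _∨_; not; if_then_else_)
open import Data.Fin using (Fin; zero; suc; toℕ; pred)
open import Data.Fin.Properties using () renaming (_≟_ to _≟F_)
open import Data.Product using (_×_; _,_; proj₁; proj₂)
open import Data.List using (List; []; _∷_; map; concatMap; filter; length; upTo; allFin; foldr; replicate; zipWith; _++_)
open import Data.Vec using (Vec; []; _∷_; tabulate; lookup; toList)
import Data.Vec.Properties as VecP
open import Data.Product.Properties using (≡-dec)
open import Relation.Nullary using (Dec; yes; no; does)
open import Relation.Nullary.Decidable using (⌊_⌋; T?)
open import Relation.Binary.PropositionalEquality using (_≡_)

-- Positions 1..n are encoded 0-based as Fin n.  A power ε^a (ε = e^{2πi/m})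
-- is encoded by its exponent a : ℕ, always kept reduced in {0,…,m-1}.
-- An element w ∈ G(m,1,n) is encoded by the vector j ↦ (β_j , r_j),
-- meaning w(j) = ε^{r_j} β_j  (equivalently w(e_j) = ε^{r_j} e_{β_j}).

-- reduction modulo m (m ≥ 2 in the theorem; the m = 0 clause is irrelevant)
modN : ℕ → ℕ → ℕ
modN zero    a = a
modN (suc k) a = a % suc k

Elt : ℕ → Set
Elt n = Vec (Fin n × ℕ) n

_≟E_ : ∀ {n} (v w : Elt n) → Dec (v ≡ w)
_≟E_ = VecP.≡-dec (≡-dec _≟F_ _≟ℕ_)

allVecs : ∀ {A : Set} → List A → (n : ℕ) → List (Vec A n)
allVecs xs zero    = [] ∷ []
allVecs xs (suc n) = concatMap (λ x → map (x ∷_) (allVecs xs n)) xs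

distinctB : ∀ {n} → List (Fin n) → Bool
distinctB []       = true
distinctB (x ∷ xs) = not (elemB x xs) ∧ distinctB xs
  where
  elemB : ∀ {n} → Fin n → List (Fin n) → Bool
  elemB y []       = false
  elemB y (z ∷ zs) = ⌊ y ≟F z ⌋ ∨ elemB y zs

G : (m n : ℕ) → List (Elt n)
G m n = filter (λ v → T? (distinctB (toList (Data.Vec.map proj₁ v))))
               (allVecs (concatMap (λ j → map (λ a → (j , a)) (upTo m)) (allFin n)) n)
  where import Data.Vec

-- product (composition, right to left): (w v)(j) = w(v(j)),
-- and w(ε^r b) = ε^r w(b).
_·_ : ∀ {m n} → Elt n → Elt n → Elt n
_·_ {m} v' w' = tabulate λ j → let b = proj₁ (lookup w' j) ; r = proj₂ (lookup w' j)
                                in proj₁ (lookup v' b) , modN m (r + proj₂ (lookup v' b))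

mul : ∀ (m : ℕ) {n} → Elt n → Elt n → Elt n
mul m v w = _·_ {m} v w

identity : ∀ {n} → Elt n
identity = tabulate λ j → (j , 0)

power : ∀ (m : ℕ) {n} → Elt n → ℕ → Elt n
power m w zero    = identity
power m w (suc k) = mul m w (power m w k)

t₁ : ∀ (m : ℕ) {n} → Elt n
t₁ m = tabulate λ j → (j , (if ⌊ toℕ j ≟ℕ 0 ⌋ then modN m 1 else 0))

-- successor on Fin n, saturating at the top (only used below the top)
up : ∀ {n} → Fin n → Fin n
up {suc zero}    zero    = zero
up {suc (suc n)} zero    = suc zero
up {suc (suc n)} (suc j) = suc (up j)

-- s_k (1 ≤ k ≤ n-1) swaps k and k+1, i.e. 0-based positions k-1 and k
s : ∀ {n} → ℕ → Elt n
s k = tabulate λ j →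
  (if ⌊ toℕ j ≟ℕ (k ∸ 1) ⌋ then up j
   else if ⌊ toℕ j ≟ℕ k ⌋ then pred j else j) , 0

σ : ∀ (m : ℕ) {n} → ℕ → Elt n
σ m zero    = t₁ m
σ m (suc i) = mul m (s (suc i)) (σ m i)

-- all exponent tuples (k₀,…,k_{n-1}) with 0 ≤ k_i ≤ m i + m - 1,
-- listed as k₀ ∷ k₁ ∷ … ; the argument i is the index of the first entry
tuples : ℕ → ℕ → ℕ → List (List ℕ)
tuples m i zero    = [] ∷ []
tuples m i (suc c) = concatMap (λ k → map (k ∷_) (tuples m (suc i) c)) (upTo (m * i + m))

tupleProd : ∀ (m : ℕ) {n} → ℕ → List ℕ → Elt n
tupleProd m i []       = identity
tupleProd m i (k ∷ ks) = mul m (tupleProd m (suc i) ks) (power m (σ m i) k)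

-- fmaj(w) = Σ k_i for the (unique) expression of w; found by search
fmaj : ∀ (m : ℕ) {n} → Elt n → ℕ
fmaj m {n} w = go (tuples m 0 n)
  where
  go : List (List ℕ) → ℕ
  go []         = 0
  go (ks ∷ kss) = if ⌊ tupleProd m 0 ks ≟E w ⌋ then sum ks else go kss

-- A root ε^a e_p − ε^b e_q is encoded ((p , a) , (q , b)), i.e.
-- roots are treated as formal differences of the pair of "signed basis
-- vectors" ε^a e_p ≠ ε^b e_q (for even m ≥ 4
-- distinct formal roots can be equal as vectors of ℂⁿ, e.g. 1 − i =
-- (−i) − (−1), and the statement is false for the set-of-vectors reading).

Root : ℕ → Set
Root n = (Fin n × ℕ) × (Fin n × ℕ)

posB : ∀ {n} → Root n → Bool
posB ((p , a) , (q , b)) with p ≟F q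
... | yes _ = ⌊ a <? b ⌋
... | no  _ = (⌊ a ≟ℕ 0 ⌋ ∧ ⌊ toℕ q <? toℕ p ⌋) ∨ (not ⌊ b ≟ℕ 0 ⌋ ∧ ⌊ toℕ p <? toℕ q ⌋)

Δ : ∀ (m n : ℕ) → List (Root n)
Δ m n = concatMap (λ j → concatMap (λ l → concatMap (λ k →
          if ⌊ toℕ l <? suc (toℕ j) ⌋ ∧ not (⌊ l ≟F j ⌋ ∧ ⌊ k ≟ℕ 0 ⌋)
          then ((j , 0) , (l , k)) ∷ [] else [])
        (upTo m)) (allFin n)) (allFin n)

act : ∀ (m : ℕ) {n} → Elt n → Fin n × ℕ → Fin n × ℕ
act m w (p , a) = proj₁ (lookup w p) , modN m (a + proj₂ (lookup w p))

actRoot : ∀ (m : ℕ) {n} → Elt n → Root n → Root n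
actRoot m w (x , y) = act m w x , act m w y

-- L(w) = |w(Δ) ∩ Φ⁻|  (w acts injectively on roots, so count δ ∈ Δ with w(δ) ∉ Φ⁺)
L : ∀ (m : ℕ) {n} → Elt n → ℕ
L m {n} w = length (filter (λ δ → T? (not (posB (actRoot m w δ)))) (Δ m n))

-- polynomials in q with ℕ coefficients, as coefficient lists (constant first)

Poly : Set
Poly = List ℕ

_⊕_ : Poly → Poly → Poly
[]       ⊕ ys       = ys
(x ∷ xs) ⊕ []       = x ∷ xs
(x ∷ xs) ⊕ (y ∷ ys) = (x + y) ∷ (xs ⊕ ys)

_⊗_ : Poly → Poly → Poly
[]       ⊗ ys = []
(x ∷ xs) ⊗ ys = map (x *_) ys ⊕ (0 ∷ (xs ⊗ ys))

coeff : Poly → ℕ → ℕ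
coeff []       d       = 0
coeff (x ∷ xs) zero    = x
coeff (x ∷ xs) (suc d) = coeff xs d

-- (1 − q^N)/(1 − q) = 1 + q + ⋯ + q^{N-1}
qint : ℕ → Poly
qint N = replicate N 1

prodPoly : ℕ → ℕ → Poly
prodPoly m zero    = 1 ∷ []
prodPoly m (suc n) = prodPoly m n ⊗ qint (suc n * m)

-- number of w ∈ G(m,1,n) with statistic value d (coefficient of q^d)
countStat : ∀ (m n : ℕ) → (Elt n → ℕ) → ℕ → ℕ
countStat m n f d = length (filter (λ w → f w ≟ℕ d) (G m n))

-- Both statistics are distributed on G(m,1,n) like the sums k₀ + ⋯ + k_{n-1} with 0 ≤ k_i < m(i+1),
-- whose generating function is ∏_{i=1}^{n} [im]_q.
-- For L: each w ∈ G(m,1,n+1) arises from a unique w′ ∈ G(m,1,n) by choosing the image ε^r p of the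
-- letter n+1, and then L(w) = L(w′) + c(p, r), where c maps the m(n+1) choices of (p, r) bijectively
-- onto {0, …, m(n+1) − 1}.
-- For fmaj: (k₀, …, k_{n-1}) ↦ σ_{n-1}^{k_{n-1}} ⋯ σ₀^{k₀} is injective, because σ₀, …, σ_{n-2} fix the
-- letter n while the powers σ_{n-1}^k with k < mn send it to distinct coloured letters, so k_{n-1} can be
-- read off and cancelled; there are as many tuples as elements, so it is a bijection, and fmaj of the
-- image is k₀ + ⋯ + k_{n-1}.

module Submission where

open import Defs
open import Data.Nat using (ℕ; zero; suc; _+_; _*_; _∸_; _≤_; _<_; z≤n; s≤s; z<s; s<s)
open import Data.Nat.Properties
open import Algebra.Properties.CommutativeSemigroup +-commutativeSemigroup using () renaming (x∙yz≈y∙xz to m+[n+o]≡n+[m+o])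
open import Data.Product using (Σ; ∃; ∃₂; _×_; _,_; proj₁; proj₂; swap)
open import Data.Product.Properties using (,-injectiveˡ; ,-injectiveʳ; ×-≡,≡→≡)
open import Data.Sum using (_⊎_; inj₁; inj₂)
open import Data.Bool using (Bool; true; false; _∧_; _∨_; not; T; if_then_else_)
open import Data.Bool.Properties using (T-∧; T-not-≡; ∧-zeroʳ; ∧-identityʳ; ∨-identityʳ; not-involutive)
open import Data.Fin as Fin using (Fin; zero; suc; toℕ)
import Data.Fin.Properties as Finₚ
open import Data.Fin.Properties using () renaming (_≟_ to _≟ᶠ_; 0≢1+n to zero≢suc; suc-injective to Fin-suc-injective)
open import Data.Vec as Vec using (Vec; []; _∷_; lookup; toList)
import Data.Vec.Properties as Vec
open import Data.Nat.ListAction using (sum)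
open import Data.Nat.ListAction.Properties using (sum-++)
open import Data.Nat.Tactic.RingSolver using (solve-∀)
open import Data.Nat.DivMod
  using (_%_; _/_; m≡m%n+[m/n]*n; m<n*o⇒m/o<n; m<n⇒m%n≡m; [m+n]%n≡m%n; %-distribˡ-+; m%n%n≡m%n; m%n<n; [m+kn]%n≡m%n)
open import Data.Empty using (⊥-elim)
import Data.List as List
open import Data.List
  using (List; []; _∷_; _++_; map; filter; length; upTo; applyUpTo; allFin; concatMap; cartesianProductWith; cartesianProduct)
open import Data.List.Properties
  using ( ∷-injectiveˡ; ∷-injectiveʳ; ∷ʳ-injective; length-++; length-map; length-upTo; length-tabulate
        ; map-++; map-∘; map-id; map-cong-local; map-applyUpTo; filter-accept; filter-reject; filter-++)
open import Data.List.Membership.Propositional using (_∈_)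
open import Data.List.Membership.Propositional.Properties
  using ( ∈-map⁻; ∈-∃++; ∈-filter⁺; ∈-filter⁻; ∈-allFin; ∈-upTo⁺; ∈-upTo⁻
        ; ∈-cartesianProduct⁺; ∈-cartesianProduct⁻; ∈-cartesianProductWith⁺; ∈-cartesianProductWith⁻)
open import Data.List.Membership.Propositional.Properties.WithK using (unique∧set⇒bag)
import Data.List.Membership.DecPropositional as Membership
open import Data.List.Relation.Unary.Any using (here; there)
open import Data.List.Relation.Unary.All as All using (All; []; _∷_)
open import Data.List.Relation.Unary.All.Properties using (¬Any⇒All¬) renaming (map⁺ to All-map⁺)
open import Data.List.Relation.Binary.Subset.Propositional using (_⊆_)
open import Data.List.Relation.Unary.Unique.Propositional using (Unique; []; _∷_)
import Data.List.Relation.Unary.Unique.Propositional.Properties as Unique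
open import Data.List.Relation.Binary.Permutation.Propositional as Perm
  using (_↭_; ↭-refl; ↭-trans; module PermutationReasoning)
import Data.List.Relation.Binary.Permutation.Propositional.Properties as ↭
open import Data.List.Relation.Binary.BagAndSetEquality using (∼bag⇒↭)
open import Function using (_∘_; _∋_; id)
open import Function.Bundles using (mk⇔; module Equivalence)
open import Function.Definitions using (Injective)
open import Relation.Nullary using (¬_; Dec; yes; no)
open import Relation.Nullary.Decidable using (⌊_⌋; T?; isYes≗does; dec-true; dec-false)
open import Relation.Binary.Definitions using (DecidableEquality; tri<; tri≈; tri>)
open import Relation.Binary.PropositionalEquality
  using (_≡_; _≢_; refl; sym; trans; cong; cong₂; cong-app; subst; subst₂; module ≡-Reasoning)

module _ {A : Set} where
  open import Function.Endo.Propositional A public using (_^_; ^-homo)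

private
  variable
    A B C D E : Set

isYes-true : ∀ {P : Set} (p? : Dec P) → P → ⌊ p? ⌋ ≡ true
isYes-true p? p = trans (isYes≗does p?) (dec-true p? p)

isYes-false : ∀ {P : Set} (p? : Dec P) → ¬ P → ⌊ p? ⌋ ≡ false
isYes-false p? ¬p = trans (isYes≗does p?) (dec-false p? ¬p)

isYes-⇔ : ∀ {P Q : Set} (p? : Dec P) (q? : Dec Q) → (P → Q) → (Q → P) → ⌊ p? ⌋ ≡ ⌊ q? ⌋
isYes-⇔ p? q? to from with q?
... | yes q = isYes-true p? (from q)
... | no ¬q = isYes-false p? (¬q ∘ to)

concatMap-map : (f : A → B → C) (xs : List A) (ys : List B) →
  concatMap (λ x → map (f x) ys) xs ≡ cartesianProductWith f xs ys
concatMap-map f []       ys = refl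
concatMap-map f (x ∷ xs) ys = cong (map (f x) ys ++_) (concatMap-map f xs ys)

length-cartesianProductWith : (f : A → B → C) (xs : List A) (ys : List B) →
  length (cartesianProductWith f xs ys) ≡ length xs * length ys
length-cartesianProductWith f []       ys = refl
length-cartesianProductWith f (x ∷ xs) ys = begin
  length (map (f x) ys ++ cartesianProductWith f xs ys)  ≡⟨ length-++ (map (f x) ys) ⟩
  length (map (f x) ys) + length (cartesianProductWith f xs ys)
    ≡⟨ cong₂ _+_ (length-map (f x) ys) (length-cartesianProductWith f xs ys) ⟩
  length ys + length xs * length ys                      ∎
  where open ≡-Reasoning

map-cartesianProductWith : (g : C → D) (f : A → B → C) (xs : List A) (ys : List B) →
  map g (cartesianProductWith f xs ys) ≡ cartesianProductWith (λ x y → g (f x y)) xs ys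
map-cartesianProductWith g f []       ys = refl
map-cartesianProductWith g f (x ∷ xs) ys =
  trans (map-++ g (map (f x) ys) _) (cong₂ _++_ (sym (map-∘ ys)) (map-cartesianProductWith g f xs ys))

cartesianProductWith-mapˡ : (f : A → B → C) (g : D → A) (xs : List D) (ys : List B) →
  cartesianProductWith f (map g xs) ys ≡ cartesianProductWith (λ x → f (g x)) xs ys
cartesianProductWith-mapˡ f g []       ys = refl
cartesianProductWith-mapˡ f g (x ∷ xs) ys = cong (map (f (g x)) ys ++_) (cartesianProductWith-mapˡ f g xs ys)

cartesianProductWith-mapʳ : (f : A → B → C) (h : D → B) (xs : List A) (ys : List D) →
  cartesianProductWith f xs (map h ys) ≡ cartesianProductWith (λ x y → f x (h y)) xs ys
cartesianProductWith-mapʳ f h []       ys = refl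
cartesianProductWith-mapʳ f h (x ∷ xs) ys = cong₂ _++_ (sym (map-∘ ys)) (cartesianProductWith-mapʳ f h xs ys)

cartesianProductWith-cong : {f f′ : A → B → C} (xs : List A) (ys : List B) →
  (∀ {x y} → x ∈ xs → y ∈ ys → f x y ≡ f′ x y) →
  cartesianProductWith f xs ys ≡ cartesianProductWith f′ xs ys
cartesianProductWith-cong []       ys eq = refl
cartesianProductWith-cong (x ∷ xs) ys eq =
  cong₂ _++_ (map-cong-local (All.tabulate (eq (here refl)))) (cartesianProductWith-cong xs ys (eq ∘ there))

cartesianProductWith-↭ : (f : A → B → C) {xs xs′ : List A} {ys ys′ : List B} →
  xs ↭ xs′ → ys ↭ ys′ → cartesianProductWith f xs ys ↭ cartesianProductWith f xs′ ys′
cartesianProductWith-↭ f {xs′ = xs′} p q = ↭-trans (left p) (right xs′ q)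
  where
  right : ∀ xs {ys ys′} → ys ↭ ys′ → cartesianProductWith f xs ys ↭ cartesianProductWith f xs ys′
  right []       q = ↭-refl
  right (x ∷ xs) q = ↭.++⁺ (↭.map⁺ (f x) q) (right xs q)
  left : ∀ {xs xs′ ys} → xs ↭ xs′ → cartesianProductWith f xs ys ↭ cartesianProductWith f xs′ ys
  left           Perm.refl         = ↭-refl
  left {ys = ys} (Perm.prep x p)   = ↭.++⁺ˡ (map (f x) ys) (left p)
  left {ys = ys} (Perm.swap x y p) =
    ↭-trans (↭.shifts (map (f x) ys) (map (f y) ys)) (↭.++⁺ˡ (map (f y) ys) (↭.++⁺ˡ (map (f x) ys) (left p)))
  left           (Perm.trans p q)  = ↭-trans (left p) (left q)

Unique-⊆⇒length≤ : {xs ys : List A} → Unique xs → xs ⊆ ys → length xs ≤ length ys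
Unique-⊆⇒length≤ {xs = []}     _          _   = z≤n
Unique-⊆⇒length≤ {xs = x ∷ xs} (x∉ ∷ xs!) sub with ∈-∃++ (sub (here refl))
... | as , bs , refl = begin
  suc (length xs)           ≤⟨ s≤s (Unique-⊆⇒length≤ xs! sub′) ⟩
  suc (length (as ++ bs))   ≡⟨ ↭.↭-length (↭.shift x as bs) ⟨
  length (as ++ x ∷ bs)     ∎
  where
  open ≤-Reasoning
  sub′ : xs ⊆ as ++ bs
  sub′ z∈ with ↭.∈-resp-↭ (↭.shift x as bs) (sub (there z∈))
  ... | here refl = ⊥-elim (All.lookup x∉ z∈ refl)
  ... | there z∈′ = z∈′

Unique-⊆-⊇⇒↭ : {xs ys : List A} → Unique xs → Unique ys → xs ⊆ ys → ys ⊆ xs → xs ↭ ys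
Unique-⊆-⊇⇒↭ xs! ys! sub sup = ∼bag⇒↭ (unique∧set⇒bag xs! ys! (mk⇔ sub sup))

Unique-⊆-length⇒↭ : DecidableEquality A → {xs ys : List A} → Unique xs → Unique ys →
  xs ⊆ ys → length ys ≤ length xs → xs ↭ ys
Unique-⊆-length⇒↭ _≟_ {xs} {ys} xs! ys! sub len = Unique-⊆-⊇⇒↭ xs! ys! sub sup
  where
  sup : ys ⊆ xs
  sup {z} z∈ys with Membership._∈?_ _≟_ z xs
  ... | yes z∈xs = z∈xs
  ... | no  z∉xs = ⊥-elim (<-irrefl refl (≤-trans (Unique-⊆⇒length≤ (¬Any⇒All¬ xs z∉xs ∷ xs!) z∷xs⊆ys) len))
    where
    z∷xs⊆ys : z ∷ xs ⊆ ys
    z∷xs⊆ys (here refl) = z∈ys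
    z∷xs⊆ys (there p)   = sub p

Unique-map⁺-∈ : (f : A → B) {xs : List A} → (∀ {x y} → x ∈ xs → y ∈ xs → f x ≡ f y → x ≡ y) →
  Unique xs → Unique (map f xs)
Unique-map⁺-∈ f {[]}     inj []          = []
Unique-map⁺-∈ f {x ∷ xs} inj (x∉ ∷ xs!) =
  All-map⁺ (All.tabulate (λ {y} y∈ fx≡fy → All.lookup x∉ y∈ (inj (here refl) (there y∈) fx≡fy)))
  ∷ Unique-map⁺-∈ f (λ x∈ y∈ → inj (there x∈) (there y∈)) xs!

count : ℕ → List ℕ → ℕ
count d xs = length (filter (_≟ d) xs)

count-map : (f : A → ℕ) (d : ℕ) (xs : List A) → length (filter (λ x → f x ≟ d) xs) ≡ count d (map f xs)
count-map f d []       = refl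
count-map f d (x ∷ xs) with f x ≟ d
... | yes p = begin
  length (filter (λ x → f x ≟ d) (x ∷ xs)) ≡⟨ cong length (filter-accept (λ x → f x ≟ d) p) ⟩
  suc (length (filter (λ x → f x ≟ d) xs)) ≡⟨ cong suc (count-map f d xs) ⟩
  suc (count d (map f xs))                 ≡⟨ cong length (filter-accept (_≟ d) p) ⟨
  count d (map f (x ∷ xs))                 ∎
  where open ≡-Reasoning
... | no ¬p = begin
  length (filter (λ x → f x ≟ d) (x ∷ xs)) ≡⟨ cong length (filter-reject (λ x → f x ≟ d) ¬p) ⟩
  length (filter (λ x → f x ≟ d) xs)       ≡⟨ count-map f d xs ⟩
  count d (map f xs)                       ≡⟨ cong length (filter-reject (_≟ d) ¬p) ⟨
  count d (map f (x ∷ xs))                 ∎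
  where open ≡-Reasoning

count-↭ : (d : ℕ) {xs ys : List ℕ} → xs ↭ ys → count d xs ≡ count d ys
count-↭ d p = ↭.↭-length (↭.filter-↭ (_≟ d) p)

count-++ : (d : ℕ) (xs ys : List ℕ) → count d (xs ++ ys) ≡ count d xs + count d ys
count-++ d xs ys = trans (cong length (filter-++ (_≟ d) xs ys)) (length-++ (filter (_≟ d) xs))

-- Generating polynomials

coeff-⊕ : ∀ p q d → coeff (p ⊕ q) d ≡ coeff p d + coeff q d
coeff-⊕ []      q       d       = refl
coeff-⊕ (x ∷ p) []      d       = sym (+-identityʳ _)
coeff-⊕ (x ∷ p) (y ∷ q) zero    = refl
coeff-⊕ (x ∷ p) (y ∷ q) (suc d) = coeff-⊕ p q d

coeff-⊗-[] : ∀ p d → coeff (p ⊗ []) d ≡ 0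
coeff-⊗-[] []      d       = refl
coeff-⊗-[] (x ∷ p) zero    = refl
coeff-⊗-[] (x ∷ p) (suc d) = coeff-⊗-[] p d

coeff-⊗-∷ : ∀ p y q d → coeff (p ⊗ (y ∷ q)) d ≡ y * coeff p d + coeff (0 ∷ (p ⊗ q)) d
coeff-⊗-∷ []      y q zero    = cong (_+ 0) (sym (*-zeroʳ y))
coeff-⊗-∷ []      y q (suc d) = cong (_+ 0) (sym (*-zeroʳ y))
coeff-⊗-∷ (x ∷ p) y q zero    = trans (+-identityʳ (x * y)) (trans (*-comm x y) (sym (+-identityʳ (y * x))))
coeff-⊗-∷ (x ∷ p) y q (suc d) = begin
  coeff (map (x *_) q ⊕ (p ⊗ (y ∷ q))) d                 ≡⟨ coeff-⊕ (map (x *_) q) (p ⊗ (y ∷ q)) d ⟩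
  coeff (map (x *_) q) d + coeff (p ⊗ (y ∷ q)) d         ≡⟨ cong (coeff (map (x *_) q) d +_) (coeff-⊗-∷ p y q d) ⟩
  coeff (map (x *_) q) d + (y * coeff p d + coeff (0 ∷ (p ⊗ q)) d)
    ≡⟨ m+[n+o]≡n+[m+o] (coeff (map (x *_) q) d) (y * coeff p d) (coeff (0 ∷ (p ⊗ q)) d) ⟩
  y * coeff p d + (coeff (map (x *_) q) d + coeff (0 ∷ (p ⊗ q)) d)
    ≡⟨ cong (y * coeff p d +_) (coeff-⊕ (map (x *_) q) (0 ∷ (p ⊗ q)) d) ⟨
  y * coeff p d + coeff (map (x *_) q ⊕ (0 ∷ (p ⊗ q))) d ∎
  where open ≡-Reasoning

count-zero-map-suc : ∀ xs → count 0 (map suc xs) ≡ 0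
count-zero-map-suc []       = refl
count-zero-map-suc (x ∷ xs) = count-zero-map-suc xs

count-map-injective : (f : ℕ → ℕ) → (∀ {a b} → f a ≡ f b → a ≡ b) →
  ∀ d xs → count (f d) (map f xs) ≡ count d xs
count-map-injective f f-inj d []       = refl
count-map-injective f f-inj d (x ∷ xs) with x ≟ d
... | yes x≡d = trans (cong length (filter-accept (_≟ f d) (cong f x≡d)))
                      (trans (cong suc (count-map-injective f f-inj d xs)) (sym (cong length (filter-accept (_≟ d) x≡d))))
... | no  x≢d = trans (cong length (filter-reject (_≟ f d) (x≢d ∘ f-inj)))
                      (trans (count-map-injective f f-inj d xs) (sym (cong length (filter-reject (_≟ d) x≢d))))

count-+-upTo : ∀ N {xs p} → (∀ e → count e xs ≡ coeff p e) →
  ∀ d → count d (cartesianProductWith _+_ (upTo N) xs) ≡ coeff (p ⊗ qint N) d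
count-+-upTo zero    {xs} {p} hyp d = sym (coeff-⊗-[] p d)
count-+-upTo (suc N) {xs} {p} hyp d = begin
  count d (map (0 +_) xs ++ shifted)        ≡⟨ count-++ d (map (0 +_) xs) shifted ⟩
  count d (map (0 +_) xs) + count d shifted ≡⟨ cong₂ _+_ (trans (cong (count d) (map-id xs)) (hyp d)) (count-shifted d) ⟩
  coeff p d + coeff (0 ∷ (p ⊗ qint N)) d    ≡⟨ cong (_+ coeff (0 ∷ (p ⊗ qint N)) d) (*-identityˡ (coeff p d)) ⟨
  1 * coeff p d + coeff (0 ∷ (p ⊗ qint N)) d ≡⟨ coeff-⊗-∷ p 1 (qint N) d ⟨
  coeff (p ⊗ qint (suc N)) d                 ∎
  where
  open ≡-Reasoning
  shifted : List ℕ
  shifted = cartesianProductWith _+_ (applyUpTo suc N) xs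
  shifted≡ : shifted ≡ map suc (cartesianProductWith _+_ (upTo N) xs)
  shifted≡ = begin
    cartesianProductWith _+_ (applyUpTo suc N) xs        ≡⟨ cong (λ ks → cartesianProductWith _+_ ks xs) (map-applyUpTo id suc N) ⟨
    cartesianProductWith _+_ (map suc (upTo N)) xs       ≡⟨ cartesianProductWith-mapˡ _+_ suc (upTo N) xs ⟩
    cartesianProductWith (λ k l → suc (k + l)) (upTo N) xs ≡⟨ map-cartesianProductWith suc _+_ (upTo N) xs ⟨
    map suc (cartesianProductWith _+_ (upTo N) xs)       ∎
  count-shifted : ∀ d → count d shifted ≡ coeff (0 ∷ (p ⊗ qint N)) d
  count-shifted zero    = trans (cong (count 0) shifted≡) (count-zero-map-suc (cartesianProductWith _+_ (upTo N) xs))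
  count-shifted (suc d) = trans (cong (count (suc d)) shifted≡)
    (trans (count-map-injective suc suc-injective d (cartesianProductWith _+_ (upTo N) xs)) (count-+-upTo N {xs} {p} hyp d))

sums : ℕ → ℕ → List ℕ
sums m zero    = 0 ∷ []
sums m (suc n) = cartesianProductWith _+_ (upTo (m * n + m)) (sums m n)

count-sums : ∀ m n d → count d (sums m n) ≡ coeff (prodPoly m n) d
count-sums m zero    zero    = refl
count-sums m zero    (suc d) = refl
count-sums m (suc n) d = trans (count-+-upTo (m * n + m) {sums m n} {prodPoly m n} (count-sums m n) d)
  (cong (λ N → coeff (prodPoly m n ⊗ qint N) d) (trans (+-comm (m * n) m) (cong (m +_) (*-comm m n))))

-- The elements of G(m,1,n)

β : ∀ {n l} → Vec (Fin n × ℕ) l → Fin l → Fin n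
β v j = proj₁ (lookup v j)

exponent : ∀ {n l} → Vec (Fin n × ℕ) l → Fin l → ℕ
exponent v j = proj₂ (lookup v j)

Reduced : ℕ → ∀ {n l} → Vec (Fin n × ℕ) l → Set
Reduced m v = ∀ j → exponent v j < m

InG : ℕ → ∀ {n} → Elt n → Set
InG m w = Reduced m w × Injective _≡_ _≡_ (β w)

elemB : ∀ {n} → Fin n → List (Fin n) → Bool
elemB y []       = false
elemB y (z ∷ zs) = ⌊ y ≟ᶠ z ⌋ ∨ elemB y zs

elemB-unique : ∀ {n} {E : Fin n → List (Fin n) → List (Fin n) → Bool} →
  (∀ y P → E y P [] ≡ false) → (∀ y P z zs → E y P (z ∷ zs) ≡ (⌊ y ≟ᶠ z ⌋ ∨ E y P zs)) →
  ∀ y P zs → E y P zs ≡ elemB y zs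
elemB-unique e₀ e₁ y P []       = e₀ y P
elemB-unique e₀ e₁ y P (z ∷ zs) = trans (e₁ y P z zs) (cong (⌊ y ≟ᶠ z ⌋ ∨_) (elemB-unique e₀ e₁ y P zs))

-- `distinctB` tests membership with a function local to its definition, which cannot be named.
-- `localTerm` captures the occurrence of that function in an unfolding of `distinctB`; once its
-- arguments are generalised by `with` to fresh variables, unification identifies it with the `E` of
-- `elemB-unique` (the triple keeps those variables out of the context of `E`).
private
  localTerm : ∀ {n} {y a : Fin n} {F R d : Bool} → not (⌊ y ≟ᶠ a ⌋ ∨ F) ∧ R ≡ d → F ≡ F
  localTerm _ = refl

  distinctB-∷∷ : ∀ {n} (q : Fin n × Fin n × List (Fin n)) →
    distinctB (proj₁ q ∷ proj₁ (proj₂ q) ∷ proj₂ (proj₂ q)) ≡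
    (not (elemB (proj₁ q) (proj₁ (proj₂ q) ∷ proj₂ (proj₂ q))) ∧ distinctB (proj₁ (proj₂ q) ∷ proj₂ (proj₂ q)))
  distinctB-∷∷ {n} q with elemB-unique {n} (λ _ _ → refl) (λ _ _ _ _ → refl)
                    | localTerm {y = proj₁ q} {a = proj₁ (proj₂ q)}
                                (refl {x = distinctB (proj₁ q ∷ proj₁ (proj₂ q) ∷ proj₂ (proj₂ q))})
  ... | E≡elemB | F≡F with (List (Fin n) ∋ proj₁ (proj₂ q) ∷ proj₂ (proj₂ q)) | proj₁ q | proj₂ (proj₂ q)
  ... | P | Y | B = let _ = trans (sym F≡F) (E≡elemB Y P B) in
    cong (λ b → not (⌊ Y ≟ᶠ proj₁ (proj₂ q) ⌋ ∨ b) ∧ distinctB (proj₁ (proj₂ q) ∷ B))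
         (E≡elemB Y (proj₁ (proj₂ q) ∷ B) B)

distinctB-∷ : ∀ {n} (y : Fin n) zs → distinctB (y ∷ zs) ≡ (not (elemB y zs) ∧ distinctB zs)
distinctB-∷ y []      = refl
distinctB-∷ y (a ∷ A) = distinctB-∷∷ (y , a , A)

elemB-false⇒ : ∀ {n l} y (v : Vec (Fin n × ℕ) l) → elemB y (toList (Vec.map proj₁ v)) ≡ false → ∀ j → y ≢ β v j
elemB-false⇒ y (x ∷ v) e j eq with y ≟ᶠ proj₁ x | j
elemB-false⇒ y (x ∷ v) () j eq | yes _ | _
... | no y≢x | zero  = y≢x eq
... | no _   | suc j = elemB-false⇒ y v e j eq

⇒elemB-false : ∀ {n l} y (v : Vec (Fin n × ℕ) l) → (∀ j → y ≢ β v j) → elemB y (toList (Vec.map proj₁ v)) ≡ false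
⇒elemB-false y []      y∉ = refl
⇒elemB-false y (x ∷ v) y∉ with y ≟ᶠ proj₁ x
... | yes y≡x = ⊥-elim (y∉ zero y≡x)
... | no  _   = ⇒elemB-false y v (y∉ ∘ suc)

distinctB⇒injective : ∀ {n l} (v : Vec (Fin n × ℕ) l) → T (distinctB (toList (Vec.map proj₁ v))) →
  Injective _≡_ _≡_ (β v)
distinctB⇒injective (x ∷ v) t {i} {j} eq
  with Equivalence.to (T-∧ {not (elemB (proj₁ x) (toList (Vec.map proj₁ v)))})
                      (subst T (distinctB-∷ (proj₁ x) (toList (Vec.map proj₁ v))) t)
... | x∉ , t′ with i | j
... | zero  | zero  = refl
... | zero  | suc j = ⊥-elim (elemB-false⇒ (proj₁ x) v (Equivalence.to T-not-≡ x∉) j eq)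
... | suc i | zero  = ⊥-elim (elemB-false⇒ (proj₁ x) v (Equivalence.to T-not-≡ x∉) i (sym eq))
... | suc i | suc j = cong suc (distinctB⇒injective v t′ eq)

injective⇒distinctB : ∀ {n l} (v : Vec (Fin n × ℕ) l) → Injective _≡_ _≡_ (β v) →
  T (distinctB (toList (Vec.map proj₁ v)))
injective⇒distinctB []      inj = _
injective⇒distinctB (x ∷ v) inj =
  subst T (sym (distinctB-∷ (proj₁ x) (toList (Vec.map proj₁ v))))
    (Equivalence.from (T-∧ {not (elemB (proj₁ x) (toList (Vec.map proj₁ v)))})
      ( Equivalence.from T-not-≡ (⇒elemB-false (proj₁ x) v (λ j eq → zero≢suc (inj eq)))
      , injective⇒distinctB v (Fin-suc-injective ∘ inj)))

allVecs-suc : (xs : List A) (n : ℕ) → allVecs xs (suc n) ≡ cartesianProductWith _∷_ xs (allVecs xs n)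
allVecs-suc xs n = concatMap-map _∷_ xs (allVecs xs n)

∈-allVecs⁻ : (xs : List A) (n : ℕ) {v : Vec A n} → v ∈ allVecs xs n → ∀ j → lookup v j ∈ xs
∈-allVecs⁻ xs (suc n) {x ∷ v} v∈ j
  with ∈-cartesianProductWith⁻ _∷_ xs (allVecs xs n) (subst (x ∷ v ∈_) (allVecs-suc xs n) v∈)
... | _ , _ , y∈ , w∈ , refl with j
... | zero  = y∈
... | suc j = ∈-allVecs⁻ xs n w∈ j

∈-allVecs⁺ : (xs : List A) (n : ℕ) (v : Vec A n) → (∀ j → lookup v j ∈ xs) → v ∈ allVecs xs n
∈-allVecs⁺ xs zero    []      _   = here refl
∈-allVecs⁺ xs (suc n) (x ∷ v) all = subst (x ∷ v ∈_) (sym (allVecs-suc xs n))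
  (∈-cartesianProductWith⁺ _∷_ (all zero) (∈-allVecs⁺ xs n v (all ∘ suc)))

Unique-allVecs : {xs : List A} (n : ℕ) → Unique xs → Unique (allVecs xs n)
Unique-allVecs           zero    _   = [] ∷ []
Unique-allVecs {xs = xs} (suc n) xs! = subst Unique (sym (allVecs-suc xs n))
  (Unique.cartesianProductWith⁺ _∷_ (λ eq → Vec.∷-injectiveˡ eq , Vec.∷-injectiveʳ eq) xs! (Unique-allVecs n xs!))

-- The coloured letters ε^r j, encoded as pairs (j , r).
letters : ℕ → (n : ℕ) → List (Fin n × ℕ)
letters m n = cartesianProduct (allFin n) (upTo m)

∈-letters : ∀ {m n} {j : Fin n} {r} → r < m → (j , r) ∈ letters m n
∈-letters r<m = ∈-cartesianProduct⁺ (∈-allFin _) (∈-upTo⁺ r<m)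

∈-letters⁻ : ∀ {m n} {j : Fin n} {r} → (j , r) ∈ letters m n → r < m
∈-letters⁻ {m} {n} jr∈ = ∈-upTo⁻ (proj₂ (∈-cartesianProduct⁻ (allFin n) (upTo m) jr∈))

Unique-letters : ∀ m n → Unique (letters m n)
Unique-letters m n = Unique.cartesianProduct⁺ (Unique.allFin⁺ n) (Unique.upTo⁺ m)

private
  distinct? : ∀ {n} → (w : Elt n) → Dec (T (distinctB (toList (Vec.map proj₁ w))))
  distinct? w = T? (distinctB (toList (Vec.map proj₁ w)))

G≡ : ∀ m n → G m n ≡ filter distinct? (allVecs (letters m n) n)
G≡ m n = cong (λ xs → filter distinct? (allVecs xs n)) (concatMap-map _,_ (allFin n) (upTo m))

∈G⇒InG : ∀ {m n} {w : Elt n} → w ∈ G m n → InG m w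
∈G⇒InG {m} {n} {w} w∈ with ∈-filter⁻ distinct? (subst (w ∈_) (G≡ m n) w∈)
... | w∈all , t = (λ j → ∈-letters⁻ (∈-allVecs⁻ (letters m n) n w∈all j)) , distinctB⇒injective w t

InG⇒∈G : ∀ {m n} (w : Elt n) → InG m w → w ∈ G m n
InG⇒∈G {m} {n} w (reduced , inj) = subst (w ∈_) (sym (G≡ m n))
  (∈-filter⁺ distinct? (∈-allVecs⁺ (letters m n) n w (λ j → ∈-letters (reduced j))) (injective⇒distinctB w inj))

Unique-G : ∀ m n → Unique (G m n)
Unique-G m n = subst Unique (sym (G≡ m n)) (Unique.filter⁺ distinct? (Unique-allVecs n (Unique-letters m n)))

sumFin : ∀ {n} → (Fin n → ℕ) → ℕ
sumFin {zero}  g = 0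
sumFin {suc n} g = g zero + sumFin (g ∘ suc)

sumBelow : ℕ → (ℕ → ℕ) → ℕ
sumBelow zero    g = 0
sumBelow (suc M) g = g 0 + sumBelow M (g ∘ suc)

sumFin-cong : ∀ {n} {g h : Fin n → ℕ} → (∀ i → g i ≡ h i) → sumFin g ≡ sumFin h
sumFin-cong {zero}  eq = refl
sumFin-cong {suc n} eq = cong₂ _+_ (eq zero) (sumFin-cong (eq ∘ suc))

sumBelow-cong : ∀ M {g h : ℕ → ℕ} → (∀ i → i < M → g i ≡ h i) → sumBelow M g ≡ sumBelow M h
sumBelow-cong zero    eq = refl
sumBelow-cong (suc M) eq = cong₂ _+_ (eq 0 z<s) (sumBelow-cong M (λ i i<M → eq (suc i) (s<s i<M)))

sumFin-last : ∀ {n} (g : Fin (suc n) → ℕ) → sumFin g ≡ sumFin (g ∘ Fin.inject₁) + g (Fin.fromℕ n)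
sumFin-last {zero}  g = +-comm (g zero) 0
sumFin-last {suc n} g = trans (cong (g zero +_) (sumFin-last (g ∘ suc))) (sym (+-assoc (g zero) _ _))

sumBelow-last : ∀ M (g : ℕ → ℕ) → sumBelow (suc M) g ≡ sumBelow M g + g M
sumBelow-last zero    g = +-comm (g 0) 0
sumBelow-last (suc M) g = trans (cong (g 0 +_) (sumBelow-last M (g ∘ suc))) (sym (+-assoc (g 0) _ _))

sumFin-const : ∀ n c → sumFin {n} (λ _ → c) ≡ n * c
sumFin-const zero    c = refl
sumFin-const (suc n) c = cong (c +_) (sumFin-const n c)

sumBelow-const : ∀ M c → sumBelow M (λ _ → c) ≡ M * c
sumBelow-const zero    c = refl
sumBelow-const (suc M) c = cong (c +_) (sumBelow-const M c)

sumFin-punchIn : ∀ {n} (p : Fin (suc n)) (g : Fin (suc n) → ℕ) → sumFin g ≡ g p + sumFin (g ∘ Fin.punchIn p)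
sumFin-punchIn         zero    g = refl
sumFin-punchIn {suc n} (suc p) g =
  trans (cong (g zero +_) (sumFin-punchIn p (g ∘ suc))) (m+[n+o]≡n+[m+o] (g zero) (g (suc p)) _)

sumFin-injective : ∀ {n} (π : Fin n → Fin n) → Injective _≡_ _≡_ π → (g : Fin n → ℕ) → sumFin (g ∘ π) ≡ sumFin g
sumFin-injective {zero}  π inj g = refl
sumFin-injective {suc n} π inj g = begin
  g (π zero) + sumFin (g ∘ π ∘ suc)
    ≡⟨ cong (g (π zero) +_) (sumFin-cong (λ i → cong g (Finₚ.punchIn-punchOut (π₀≢ i)))) ⟨
  g (π zero) + sumFin (g ∘ Fin.punchIn (π zero) ∘ π′)
    ≡⟨ cong (g (π zero) +_) (sumFin-injective π′ π′-injective (g ∘ Fin.punchIn (π zero))) ⟩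
  g (π zero) + sumFin (g ∘ Fin.punchIn (π zero))
    ≡⟨ sumFin-punchIn (π zero) g ⟨
  sumFin g ∎
  where
  open ≡-Reasoning
  π₀≢ : ∀ i → π zero ≢ π (suc i)
  π₀≢ i = zero≢suc ∘ inj
  π′ : Fin n → Fin n
  π′ i = Fin.punchOut (π₀≢ i)
  π′-injective : Injective _≡_ _≡_ π′
  π′-injective eq = Fin-suc-injective (inj (Finₚ.punchOut-injective (π₀≢ _) (π₀≢ _) eq))

sumBelow-rotate : ∀ K (f : ℕ → ℕ) s → sumBelow (suc K) (λ k → f ((k + s) % suc K)) ≡ sumBelow (suc K) f
sumBelow-rotate K f zero    = sumBelow-cong (suc K) (λ i i<m → cong f (trans (cong (_% suc K) (+-identityʳ i)) (m<n⇒m%n≡m i<m)))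
sumBelow-rotate K f (suc s) = begin
  sumBelow (suc K) (λ k → f ((k + suc s) % suc K)) ≡⟨ sumBelow-cong (suc K) (λ i _ → cong (λ t → f (t % suc K)) (+-suc i s)) ⟩
  sumBelow (suc K) (h ∘ suc)                       ≡⟨ sumBelow-last K (h ∘ suc) ⟩
  sumBelow K (h ∘ suc) + h (suc K)                 ≡⟨ +-comm _ (h (suc K)) ⟩
  h (suc K) + sumBelow K (h ∘ suc)                 ≡⟨ cong (_+ sumBelow K (h ∘ suc)) wrap ⟩
  sumBelow (suc K) h                               ≡⟨ sumBelow-rotate K f s ⟩
  sumBelow (suc K) f                               ∎
  where
  open ≡-Reasoning
  h : ℕ → ℕ
  h k = f ((k + s) % suc K)
  wrap : h (suc K) ≡ h 0
  wrap = cong f (trans (cong (_% suc K) (+-comm (suc K) s)) ([m+n]%n≡m%n s (suc K)))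

*+-<-mono : ∀ {d a a′ s} s′ → a < a′ → s < d → a * d + s < a′ * d + s′
*+-<-mono {d} {a} {a′} s′ a<a′ s<d = <-≤-trans (+-monoʳ-< (a * d) s<d)
  (≤-trans (≤-trans (≤-reflexive (+-comm (a * d) d)) (*-monoˡ-≤ d a<a′)) (m≤m+n (a′ * d) s′))

*+-<-injective : ∀ {d} a a′ {s s′} → s < d → s′ < d → a * d + s ≡ a′ * d + s′ → a ≡ a′
*+-<-injective a a′ s<d s′<d eq with <-cmp a a′
... | tri≈ _ a≡a′ _ = a≡a′
... | tri< a<a′ _ _ = ⊥-elim (<-irrefl eq (*+-<-mono _ a<a′ s<d))
... | tri> _ _ a′<a = ⊥-elim (<-irrefl (sym eq) (*+-<-mono _ a′<a s′<d))

indicator : Bool → ℕ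
indicator true  = 1
indicator false = 0

length-filter-T? : (b : A → Bool) (xs : List A) → length (filter (T? ∘ b) xs) ≡ sum (map (indicator ∘ b) xs)
length-filter-T? b []       = refl
length-filter-T? b (x ∷ xs) with b x
... | true  = cong suc (length-filter-T? b xs)
... | false = length-filter-T? b xs

sum-map-concatMap : (g : B → ℕ) (f : A → List B) (xs : List A) →
  sum (map g (concatMap f xs)) ≡ sum (map (λ x → sum (map g (f x))) xs)
sum-map-concatMap g f []       = refl
sum-map-concatMap g f (x ∷ xs) = begin
  sum (map g (f x ++ concatMap f xs))             ≡⟨ cong sum (map-++ g (f x) (concatMap f xs)) ⟩
  sum (map g (f x) ++ map g (concatMap f xs))     ≡⟨ sum-++ (map g (f x)) _ ⟩
  sum (map g (f x)) + sum (map g (concatMap f xs)) ≡⟨ cong (sum (map g (f x)) +_) (sum-map-concatMap g f xs) ⟩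
  sum (map g (f x)) + sum (map (λ x → sum (map g (f x))) xs) ∎
  where open ≡-Reasoning

sum-map-allFin : ∀ {n} (g : Fin n → ℕ) → sum (map g (allFin n)) ≡ sumFin g
sum-map-allFin g = go g id
  where
  go : ∀ {n} (g : B → ℕ) (f : Fin n → B) → sum (map g (List.tabulate f)) ≡ sumFin (g ∘ f)
  go {n = zero}  g f = refl
  go {n = suc n} g f = cong (g (f zero) +_) (go g (f ∘ suc))

sum-map-upTo : ∀ M (g : ℕ → ℕ) → sum (map g (upTo M)) ≡ sumBelow M g
sum-map-upTo M g = go M id
  where
  go : ∀ M (f : ℕ → ℕ) → sum (map g (applyUpTo f M)) ≡ sumBelow M (g ∘ f)
  go zero    f = refl
  go (suc M) f = cong (g (f 0) +_) (go M (f ∘ suc))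

sum-map-if : (g : A → ℕ) (c : Bool) (x : A) → sum (map g (if c then x ∷ [] else [])) ≡ (if c then g x else 0)
sum-map-if g true  x = +-identityʳ (g x)
sum-map-if g false x = refl

sumBelow-≤ : ∀ M r → r < M → sumBelow M (λ y → indicator (not ⌊ r <? y ⌋)) ≡ suc r
sumBelow-≤ (suc M) zero    _         = cong suc (trans
  (sumBelow-cong M (λ y _ → cong (indicator ∘ not) (isYes-true (0 <? suc y) z<s))) (trans (sumBelow-const M 0) (*-zeroʳ M)))
sumBelow-≤ (suc M) (suc r) (s<s r<M) = cong suc (trans (sumBelow-cong M (λ y _ → cong (indicator ∘ not)
                                                         (isYes-⇔ (suc r <? suc y) (r <? y) ≤-pred s≤s)))
                                                       (sumBelow-≤ M r r<M))

sumFin-threshold : ∀ n t (X Y : ℕ) → t ≤ n → sumFin {n} (λ b → if ⌊ toℕ b <? t ⌋ then X else Y) ≡ t * X + (n ∸ t) * Y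
sumFin-threshold zero    zero    X Y z≤n       = refl
sumFin-threshold (suc n) zero    X Y z≤n       =
  trans (sumFin-cong {suc n} {g = λ b → if ⌊ toℕ b <? 0 ⌋ then X else Y} (λ b → cong (if_then X else Y) (isYes-false (toℕ b <? 0) λ ())))
        (sumFin-const (suc n) Y)
sumFin-threshold (suc n) (suc t) X Y (s≤s t≤n) =
  trans (cong (X +_) (trans (sumFin-cong {n} λ b → cong (if_then X else Y) (isYes-⇔ (suc (toℕ b) <? suc t) (toℕ b <? t) ≤-pred s≤s))
                            (sumFin-threshold n t X Y t≤n)))
        (sym (+-assoc X (t * X) _))

-- Inserting a last letter

toℕ-punchIn-< : ∀ {n} (p : Fin (suc n)) (b : Fin n) → toℕ b < toℕ p → toℕ (Fin.punchIn p b) ≡ toℕ b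
toℕ-punchIn-< (suc p) zero    _         = refl
toℕ-punchIn-< (suc p) (suc b) (s<s b<p) = cong suc (toℕ-punchIn-< p b b<p)

toℕ-punchIn-≥ : ∀ {n} (p : Fin (suc n)) (b : Fin n) → toℕ p ≤ toℕ b → toℕ (Fin.punchIn p b) ≡ suc (toℕ b)
toℕ-punchIn-≥ zero    b       _         = refl
toℕ-punchIn-≥ (suc p) (suc b) (s≤s p≤b) = cong suc (toℕ-punchIn-≥ p b p≤b)

punchIn-<-pivot : ∀ {n} (p : Fin (suc n)) (b : Fin n) →
  ⌊ toℕ (Fin.punchIn p b) <? toℕ p ⌋ ≡ ⌊ toℕ b <? toℕ p ⌋
punchIn-<-pivot p b = isYes-⇔ (_ <? _) (_ <? _) to from
  where
  to : toℕ (Fin.punchIn p b) < toℕ p → toℕ b < toℕ p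
  to lt with toℕ b <? toℕ p
  ... | yes b<p = b<p
  ... | no  b≮p = ⊥-elim (<-asym lt (subst (toℕ p <_) (sym (toℕ-punchIn-≥ p b (≮⇒≥ b≮p))) (s≤s (≮⇒≥ b≮p))))
  from : toℕ b < toℕ p → toℕ (Fin.punchIn p b) < toℕ p
  from b<p = subst (_< toℕ p) (sym (toℕ-punchIn-< p b b<p)) b<p

pivot-<-punchIn : ∀ {n} (p : Fin (suc n)) (b : Fin n) →
  ⌊ toℕ p <? toℕ (Fin.punchIn p b) ⌋ ≡ not ⌊ toℕ b <? toℕ p ⌋
pivot-<-punchIn p b with toℕ b <? toℕ p
... | yes b<p = isYes-false (_ <? _) (<-asym (subst (_< toℕ p) (sym (toℕ-punchIn-< p b b<p)) b<p))
... | no  b≮p = isYes-true (_ <? _) (subst (toℕ p <_) (sym (toℕ-punchIn-≥ p b (≮⇒≥ b≮p))) (s≤s (≮⇒≥ b≮p)))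

punchIn-< : ∀ {n} (p : Fin (suc n)) (x y : Fin n) →
  ⌊ toℕ (Fin.punchIn p x) <? toℕ (Fin.punchIn p y) ⌋ ≡ ⌊ toℕ x <? toℕ y ⌋
punchIn-< p x y = isYes-⇔ (_ <? _) (_ <? _)
  (λ lt → ≰⇒> (λ y≤x → <⇒≱ lt (Finₚ.punchIn-mono-≤ p y x y≤x)))
  (λ lt → ≰⇒> (λ py≤px → <⇒≱ lt (Finₚ.punchIn-cancel-≤ p y x py≤px)))

posB-≡ : ∀ {n} {p q : Fin n} a b → p ≡ q → posB ((p , a) , (q , b)) ≡ ⌊ a <? b ⌋
posB-≡ {p = p} {q} a b p≡q with p ≟ᶠ q
... | yes _   = refl
... | no  p≢q = ⊥-elim (p≢q p≡q)

posB-≢ : ∀ {n} {p q : Fin n} a b → p ≢ q →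
  posB ((p , a) , (q , b)) ≡ ((⌊ a ≟ 0 ⌋ ∧ ⌊ toℕ q <? toℕ p ⌋) ∨ (not ⌊ b ≟ 0 ⌋ ∧ ⌊ toℕ p <? toℕ q ⌋))
posB-≢ {p = p} {q} a b p≢q with p ≟ᶠ q
... | yes p≡q = ⊥-elim (p≢q p≡q)
... | no  _   = refl

posB-punchIn : ∀ {n} (p : Fin (suc n)) (x y : Fin n) a b →
  posB ((Fin.punchIn p x , a) , (Fin.punchIn p y , b)) ≡ posB ((x , a) , (y , b))
posB-punchIn p x y a b with x ≟ᶠ y
... | yes refl = posB-≡ {p = Fin.punchIn p x} a b refl
... | no  x≢y  = trans (posB-≢ a b (x≢y ∘ Finₚ.punchIn-injective p x y))
  (cong₂ (λ u v → (⌊ a ≟ 0 ⌋ ∧ u) ∨ (not ⌊ b ≟ 0 ⌋ ∧ v)) (punchIn-< p y x) (punchIn-< p x y))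

lastOrInject₁ : ∀ {n} (j : Fin (suc n)) → j ≡ Fin.fromℕ n ⊎ ∃ λ i → j ≡ Fin.inject₁ i
lastOrInject₁ {zero}  zero    = inj₁ refl
lastOrInject₁ {suc n} zero    = inj₂ (zero , refl)
lastOrInject₁ {suc n} (suc j) with lastOrInject₁ j
... | inj₁ refl       = inj₁ refl
... | inj₂ (i , refl) = inj₂ (suc i , refl)

lookup-ext : ∀ {n} {v w : Vec A n} → (∀ j → lookup v j ≡ lookup w j) → v ≡ w
lookup-ext {v = v} {w} eq = trans (sym (Vec.tabulate∘lookup v)) (trans (Vec.tabulate-cong eq) (Vec.tabulate∘lookup w))

-- ins w p r sends the new letter n+1 to ε^r p.
ins : ∀ {n l} → Vec (Fin n × ℕ) l → Fin (suc n) → ℕ → Vec (Fin (suc n) × ℕ) (suc l)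
ins []            p r = (p , r) ∷ []
ins ((b , a) ∷ v) p r = (Fin.punchIn p b , a) ∷ ins v p r

lookup-ins-last : ∀ {n l} (v : Vec (Fin n × ℕ) l) p r → lookup (ins v p r) (Fin.fromℕ l) ≡ (p , r)
lookup-ins-last []      p r = refl
lookup-ins-last (x ∷ v) p r = lookup-ins-last v p r

lookup-ins-inject₁ : ∀ {n l} (v : Vec (Fin n × ℕ) l) p r (j : Fin l) →
  lookup (ins v p r) (Fin.inject₁ j) ≡ (Fin.punchIn p (β v j) , exponent v j)
lookup-ins-inject₁ (x ∷ v) p r zero    = refl
lookup-ins-inject₁ (x ∷ v) p r (suc j) = lookup-ins-inject₁ v p r j

ins-injective : ∀ {n} {w w′ : Elt n} {p p′ r r′} → ins w p r ≡ ins w′ p′ r′ → (p , r) ≡ (p′ , r′) × w ≡ w′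
ins-injective {n} {w} {w′} {p} {p′} {r} {r′} eq = last≡ , lookup-ext λ j →
  let eqj = trans (sym (lookup-ins-inject₁ w p r j)) (trans (cong (λ v → lookup v (Fin.inject₁ j)) eq) (lookup-ins-inject₁ w′ p′ r′ j))
  in cong₂ _,_ (Finₚ.punchIn-injective p _ _ (trans (,-injectiveˡ eqj) (cong (λ q → Fin.punchIn q (β w′ j)) (sym p≡p′))))
               (,-injectiveʳ eqj)
  where
  last≡ : (p , r) ≡ (p′ , r′)
  last≡ = trans (sym (lookup-ins-last w p r)) (trans (cong (λ v → lookup v (Fin.fromℕ n)) eq) (lookup-ins-last w′ p′ r′))
  p≡p′ : p ≡ p′
  p≡p′ = ,-injectiveˡ last≡

ins-InG : ∀ m {n} (w : Elt n) p r → r < m → InG m w → InG m (ins w p r)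
ins-InG m {n} w p r r<m (reduced , inj) = reduced′ , inj′
  where
  reduced′ : Reduced m (ins w p r)
  reduced′ j with lastOrInject₁ j
  ... | inj₁ refl       = subst (λ x → proj₂ x < m) (sym (lookup-ins-last w p r)) r<m
  ... | inj₂ (i , refl) = subst (λ x → proj₂ x < m) (sym (lookup-ins-inject₁ w p r i)) (reduced i)
  β-inject₁ : ∀ i → β (ins w p r) (Fin.inject₁ i) ≡ Fin.punchIn p (β w i)
  β-inject₁ i = cong proj₁ (lookup-ins-inject₁ w p r i)
  β-last : β (ins w p r) (Fin.fromℕ n) ≡ p
  β-last = cong proj₁ (lookup-ins-last w p r)
  inj′ : Injective _≡_ _≡_ (β (ins w p r))
  inj′ {i} {j} eq with lastOrInject₁ i | lastOrInject₁ j
  ... | inj₁ refl        | inj₁ refl        = refl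
  ... | inj₁ refl        | inj₂ (j′ , refl) =
    ⊥-elim (Finₚ.punchInᵢ≢i p (β w j′) (trans (sym (β-inject₁ j′)) (trans (sym eq) β-last)))
  ... | inj₂ (i′ , refl) | inj₁ refl        =
    ⊥-elim (Finₚ.punchInᵢ≢i p (β w i′) (trans (sym (β-inject₁ i′)) (trans eq β-last)))
  ... | inj₂ (i′ , refl) | inj₂ (j′ , refl) =
    cong Fin.inject₁ (inj (Finₚ.punchIn-injective p _ _ (trans (sym (β-inject₁ i′)) (trans eq (β-inject₁ j′)))))

-- Every element of G(m,1,n+1) arises by insertion from one of G(m,1,n).
module Deletion {n} (w : Elt (suc n)) (inj : Injective _≡_ _≡_ (β w)) where

  p : Fin (suc n)
  p = β w (Fin.fromℕ n)

  r : ℕ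
  r = exponent w (Fin.fromℕ n)

  p≢ : ∀ (j : Fin n) → p ≢ β w (Fin.inject₁ j)
  p≢ j eq = Finₚ.fromℕ≢inject₁ (inj eq)

  del : Elt n
  del = Vec.tabulate λ j → Fin.punchOut (p≢ j) , exponent w (Fin.inject₁ j)

  lookup-del : ∀ j → lookup del j ≡ (Fin.punchOut (p≢ j) , exponent w (Fin.inject₁ j))
  lookup-del = Vec.lookup∘tabulate _

  ins-del : ins del p r ≡ w
  ins-del = lookup-ext λ j → at (lastOrInject₁ j)
    where
    at : ∀ {j} → j ≡ Fin.fromℕ n ⊎ ∃ (λ i → j ≡ Fin.inject₁ i) → lookup (ins del p r) j ≡ lookup w j
    at (inj₁ refl)       = lookup-ins-last del p r
    at (inj₂ (i , refl)) = trans (lookup-ins-inject₁ del p r i)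
      (cong₂ _,_ (trans (cong (Fin.punchIn p ∘ proj₁) (lookup-del i)) (Finₚ.punchIn-punchOut (p≢ i)))
                 (cong proj₂ (lookup-del i)))

  del-InG : ∀ m → InG m w → InG m del
  del-InG m (reduced , _) =
    (λ j → subst (λ x → proj₂ x < m) (sym (lookup-del j)) (reduced (Fin.inject₁ j))) ,
    (λ {i} {j} eq → Finₚ.inject₁-injective (inj (Finₚ.punchOut-injective (p≢ i) (p≢ j)
       (trans (sym (cong proj₁ (lookup-del i))) (trans eq (cong proj₁ (lookup-del j)))))))

module Length (K : ℕ) where

  private
    m : ℕ
    m = suc K

  inΔ : ∀ {n} → Fin n → Fin n → ℕ → Bool
  inΔ j l k = ⌊ toℕ l <? suc (toℕ j) ⌋ ∧ not (⌊ l ≟ᶠ j ⌋ ∧ ⌊ k ≟ 0 ⌋)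

  -- The contribution of the candidate root e_j − ε^k e_l to L(w).
  negativeImage : ∀ {n} → Elt n → Fin n → Fin n → ℕ → ℕ
  negativeImage w j l k = if inΔ j l k then indicator (not (posB (actRoot m w ((j , 0) , (l , k))))) else 0

  L≡sum : ∀ {n} (w : Elt n) → L m w ≡ sumFin λ j → sumFin λ l → sumBelow m (negativeImage w j l)
  L≡sum {n} w = begin
    L m w                                               ≡⟨ length-filter-T? negative (Δ m n) ⟩
    sum (map cost (Δ m n))                              ≡⟨ sum-map-concatMap cost row (allFin n) ⟩
    sum (map (λ j → sum (map cost (row j))) (allFin n)) ≡⟨ sum-map-allFin (λ j → sum (map cost (row j))) ⟩
    sumFin (λ j → sum (map cost (row j)))               ≡⟨ sumFin-cong rowSum ⟩
    sumFin (λ j → sumFin λ l → sumBelow m (negativeImage w j l)) ∎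
    where
    open ≡-Reasoning
    negative : Root n → Bool
    negative δ = not (posB (actRoot m w δ))
    cost : Root n → ℕ
    cost = indicator ∘ negative
    roots : Fin n → Fin n → ℕ → List (Root n)
    roots j l k = if inΔ j l k then ((j , 0) , (l , k)) ∷ [] else []
    cell : Fin n → Fin n → List (Root n)
    cell j l = concatMap (roots j l) (upTo m)
    row : Fin n → List (Root n)
    row j = concatMap (cell j) (allFin n)
    cellSum : ∀ j l → sum (map cost (cell j l)) ≡ sumBelow m (negativeImage w j l)
    cellSum j l = begin
      sum (map cost (cell j l))                               ≡⟨ sum-map-concatMap cost (roots j l) (upTo m) ⟩
      sum (map (λ k → sum (map cost (roots j l k))) (upTo m)) ≡⟨ sum-map-upTo m (λ k → sum (map cost (roots j l k))) ⟩
      sumBelow m (λ k → sum (map cost (roots j l k)))         ≡⟨ sumBelow-cong m (λ k _ → sum-map-if cost (inΔ j l k) ((j , 0) , (l , k))) ⟩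
      sumBelow m (negativeImage w j l)                        ∎
    rowSum : ∀ j → sum (map cost (row j)) ≡ sumFin λ l → sumBelow m (negativeImage w j l)
    rowSum j = begin
      sum (map cost (row j))                                  ≡⟨ sum-map-concatMap cost (cell j) (allFin n) ⟩
      sum (map (λ l → sum (map cost (cell j l))) (allFin n))  ≡⟨ sum-map-allFin (λ l → sum (map cost (cell j l))) ⟩
      sumFin (λ l → sum (map cost (cell j l)))                ≡⟨ sumFin-cong (cellSum j) ⟩
      sumFin (λ l → sumBelow m (negativeImage w j l))         ∎

  act-ins-inject₁ : ∀ {n} (w : Elt n) p r (j : Fin n) a →
    act m (ins w p r) (Fin.inject₁ j , a) ≡ (Fin.punchIn p (β w j) , modN m (a + exponent w j))
  act-ins-inject₁ w p r j a = cong (λ x → proj₁ x , modN m (a + proj₂ x)) (lookup-ins-inject₁ w p r j)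

  act-ins-last : ∀ {n} (w : Elt n) p r a → act m (ins w p r) (Fin.fromℕ n , a) ≡ (p , modN m (a + r))
  act-ins-last w p r a = cong (λ x → proj₁ x , modN m (a + proj₂ x)) (lookup-ins-last w p r)

  inΔ-inject₁ : ∀ {n} (j l : Fin n) k → inΔ (Fin.inject₁ j) (Fin.inject₁ l) k ≡ inΔ j l k
  inΔ-inject₁ j l k = cong₂ (λ u v → u ∧ not (v ∧ ⌊ k ≟ 0 ⌋))
    (isYes-⇔ (_ <? _) (_ <? _) (subst₂ _<_ (Finₚ.toℕ-inject₁ l) (cong suc (Finₚ.toℕ-inject₁ j)))
                               (subst₂ _<_ (sym (Finₚ.toℕ-inject₁ l)) (cong suc (sym (Finₚ.toℕ-inject₁ j)))))
    (isYes-⇔ (_ ≟ᶠ _) (_ ≟ᶠ _) Finₚ.inject₁-injective (cong Fin.inject₁))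

  inΔ-inject₁-last : ∀ {n} (j : Fin n) k → inΔ (Fin.inject₁ j) (Fin.fromℕ n) k ≡ false
  inΔ-inject₁-last {n} j k = cong (_∧ not (⌊ Fin.fromℕ n ≟ᶠ Fin.inject₁ j ⌋ ∧ ⌊ k ≟ 0 ⌋)) (isYes-false (_ <? _) n≮j+1)
    where
    n≮j+1 : ¬ toℕ (Fin.fromℕ n) < suc (toℕ (Fin.inject₁ j))
    n≮j+1 lt = <⇒≱ (Finₚ.toℕ<n j) (≤-pred (subst₂ _<_ (Finₚ.toℕ-fromℕ n) (cong suc (Finₚ.toℕ-inject₁ j)) lt))

  inΔ-last-inject₁ : ∀ {n} (l : Fin n) k → inΔ (Fin.fromℕ n) (Fin.inject₁ l) k ≡ true
  inΔ-last-inject₁ {n} l k = cong₂ (λ u v → u ∧ not (v ∧ ⌊ k ≟ 0 ⌋))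
    (isYes-true (_ <? _)
      (subst₂ _<_ (sym (Finₚ.toℕ-inject₁ l)) (cong suc (sym (Finₚ.toℕ-fromℕ n))) (m≤n⇒m≤1+n (Finₚ.toℕ<n l))))
    (isYes-false (_ ≟ᶠ _) (Finₚ.fromℕ≢inject₁ ∘ sym))

  inΔ-last-last : ∀ n k → inΔ (Fin.fromℕ n) (Fin.fromℕ n) k ≡ not ⌊ k ≟ 0 ⌋
  inΔ-last-last n k = cong₂ (λ u v → u ∧ not (v ∧ ⌊ k ≟ 0 ⌋))
    (isYes-true (toℕ (Fin.fromℕ n) <? suc (toℕ (Fin.fromℕ n))) ≤-refl) (isYes-true (Fin.fromℕ n ≟ᶠ Fin.fromℕ n) refl)

  negativeImage-inject₁ : ∀ {n} (w : Elt n) p r (j l : Fin n) k →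
    negativeImage (ins w p r) (Fin.inject₁ j) (Fin.inject₁ l) k ≡ negativeImage w j l k
  negativeImage-inject₁ w p r j l k = cong₂ (λ c b → if c then indicator (not b) else 0) (inΔ-inject₁ j l k)
    (trans (cong posB (cong₂ _,_ (act-ins-inject₁ w p r j 0) (act-ins-inject₁ w p r l k))) (posB-punchIn p _ _ _ _))

  negativeImage-inject₁-last : ∀ {n} (w : Elt n) p r (j : Fin n) k →
    negativeImage (ins w p r) (Fin.inject₁ j) (Fin.fromℕ n) k ≡ 0
  negativeImage-inject₁-last w p r j k rewrite inΔ-inject₁-last j k = refl

  negativeImage-last-inject₁ : ∀ {n} (w : Elt n) p r → r < m → (l : Fin n) → ∀ k →
    negativeImage (ins w p r) (Fin.fromℕ n) (Fin.inject₁ l) k ≡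
    indicator (not ((⌊ r ≟ 0 ⌋ ∧ ⌊ toℕ (β w l) <? toℕ p ⌋) ∨
                    (not ⌊ (k + exponent w l) % m ≟ 0 ⌋ ∧ not ⌊ toℕ (β w l) <? toℕ p ⌋)))
  negativeImage-last-inject₁ {n} w p r r<m l k rewrite inΔ-last-inject₁ l k = cong (indicator ∘ not) (begin
    posB (actRoot m (ins w p r) ((Fin.fromℕ n , 0) , (Fin.inject₁ l , k)))
      ≡⟨ cong posB (cong₂ _,_ (act-ins-last w p r 0) (act-ins-inject₁ w p r l k)) ⟩
    posB ((p , modN m (0 + r)) , (Fin.punchIn p (β w l) , modN m (k + exponent w l)))
      ≡⟨ posB-≢ _ _ (Finₚ.punchInᵢ≢i p (β w l) ∘ sym) ⟩
    (⌊ r % m ≟ 0 ⌋ ∧ ⌊ toℕ (Fin.punchIn p (β w l)) <? toℕ p ⌋) ∨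
      (not ⌊ (k + exponent w l) % m ≟ 0 ⌋ ∧ ⌊ toℕ p <? toℕ (Fin.punchIn p (β w l)) ⌋)
      ≡⟨ cong (λ a → (⌊ a ≟ 0 ⌋ ∧ _) ∨ _) (m<n⇒m%n≡m r<m) ⟩
    (⌊ r ≟ 0 ⌋ ∧ ⌊ toℕ (Fin.punchIn p (β w l)) <? toℕ p ⌋) ∨
      (not ⌊ (k + exponent w l) % m ≟ 0 ⌋ ∧ ⌊ toℕ p <? toℕ (Fin.punchIn p (β w l)) ⌋)
      ≡⟨ cong₂ (λ u v → (⌊ r ≟ 0 ⌋ ∧ u) ∨ (not ⌊ (k + exponent w l) % m ≟ 0 ⌋ ∧ v))
               (punchIn-<-pivot p (β w l)) (pivot-<-punchIn p (β w l)) ⟩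
    (⌊ r ≟ 0 ⌋ ∧ ⌊ toℕ (β w l) <? toℕ p ⌋) ∨
      (not ⌊ (k + exponent w l) % m ≟ 0 ⌋ ∧ not ⌊ toℕ (β w l) <? toℕ p ⌋) ∎)
    where open ≡-Reasoning

  negativeImage-last-last : ∀ {n} (w : Elt n) p r → r < m → ∀ k →
    negativeImage (ins w p r) (Fin.fromℕ n) (Fin.fromℕ n) k ≡
    (if not ⌊ k ≟ 0 ⌋ then indicator (not ⌊ r <? (k + r) % m ⌋) else 0)
  negativeImage-last-last {n} w p r r<m k = cong₂ (λ c b → if c then indicator (not b) else 0) (inΔ-last-last n k)
    (trans (cong posB (cong₂ _,_ (act-ins-last w p r 0) (act-ins-last w p r k)))
           (trans (posB-≡ {p = p} _ _ refl) (cong (λ a → ⌊ a <? (k + r) % m ⌋) (m<n⇒m%n≡m r<m))))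

  rowSum : ∀ (x t : Bool) s →
    sumBelow m (λ k → indicator (not ((x ∧ t) ∨ (not ⌊ (k + s) % m ≟ 0 ⌋ ∧ not t)))) ≡
    (if t then m * indicator (not x) else 1)
  rowSum x true s = trans (sumBelow-cong m λ k _ → cong (indicator ∘ not)
                            (trans (cong ((x ∧ true) ∨_) (∧-zeroʳ (not ⌊ (k + s) % m ≟ 0 ⌋)))
                                   (trans (∨-identityʳ _) (∧-identityʳ x))))
                          (sumBelow-const m (indicator (not x)))
  rowSum x false s = begin
    sumBelow m (λ k → indicator (not ((x ∧ false) ∨ (not ⌊ (k + s) % m ≟ 0 ⌋ ∧ true))))
      ≡⟨ sumBelow-cong m (λ k _ → cong (indicator ∘ not)
           (trans (cong (_∨ (not ⌊ (k + s) % m ≟ 0 ⌋ ∧ true)) (∧-zeroʳ x)) (∧-identityʳ _))) ⟩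
    sumBelow m (λ k → indicator (not (not ⌊ (k + s) % m ≟ 0 ⌋)))
      ≡⟨ sumBelow-cong m (λ k _ → cong indicator (not-involutive ⌊ (k + s) % m ≟ 0 ⌋)) ⟩
    sumBelow m (λ k → indicator ⌊ (k + s) % m ≟ 0 ⌋) ≡⟨ sumBelow-rotate K (λ y → indicator ⌊ y ≟ 0 ⌋) s ⟩
    1 + sumBelow K (λ _ → 0)                          ≡⟨ cong suc (trans (sumBelow-const K 0) (*-zeroʳ K)) ⟩
    1                                                 ∎
    where open ≡-Reasoning

  -- Of the m − 1 roots e_{n+1} − ε^k e_{n+1} (k ≠ 0), exactly r are made negative by ε^r.
  lastRowSum : ∀ r → r < m → sumBelow m (λ k → if not ⌊ k ≟ 0 ⌋ then indicator (not ⌊ r <? (k + r) % m ⌋) else 0) ≡ r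
  lastRowSum r r<m = suc-injective (begin
    suc (sumBelow K (g ∘ suc))    ≡⟨ cong (_+ sumBelow K (g ∘ suc)) g₀ ⟨
    g 0 + sumBelow K (g ∘ suc)   ≡⟨ sumBelow-rotate K (λ y → indicator (not ⌊ r <? y ⌋)) r ⟩
    sumBelow m (λ y → indicator (not ⌊ r <? y ⌋)) ≡⟨ sumBelow-≤ m r r<m ⟩
    suc r                        ∎)
    where
    open ≡-Reasoning
    g : ℕ → ℕ
    g k = indicator (not ⌊ r <? (k + r) % m ⌋)
    g₀ : g 0 ≡ 1
    g₀ = cong (indicator ∘ not) (trans (cong (λ a → ⌊ r <? a ⌋) (m<n⇒m%n≡m r<m)) (isYes-false (r <? r) (<-irrefl refl)))

  -- The growth of L when the letter n+1 is sent to ε^r p, with t = p − 1 (0-based): each root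
  -- e_{n+1} − ε^k e_l with l ≤ n and β_l < p is negative exactly when r ≠ 0, for each l with β_l > p
  -- exactly one k gives a negative root, and there are r negative roots e_{n+1} − ε^k e_{n+1}.
  increment : ℕ → ℕ → ℕ → ℕ
  increment n t r = t * (m * indicator (not ⌊ r ≟ 0 ⌋)) + (n ∸ t) + r

  lastColumnSum : ∀ {n} (w : Elt n) p r → r < m → Injective _≡_ _≡_ (β w) →
    sumFin (λ l → sumBelow m (negativeImage (ins w p r) (Fin.fromℕ n) l)) ≡ increment n (toℕ p) r
  lastColumnSum {n} w p r r<m inj = begin
    sumFin (λ l → sumBelow m (negativeImage (ins w p r) (Fin.fromℕ n) l))
      ≡⟨ sumFin-last (λ l → sumBelow m (negativeImage (ins w p r) (Fin.fromℕ n) l)) ⟩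
    sumFin (λ l → sumBelow m (negativeImage (ins w p r) (Fin.fromℕ n) (Fin.inject₁ l)))
      + sumBelow m (negativeImage (ins w p r) (Fin.fromℕ n) (Fin.fromℕ n))
      ≡⟨ cong₂ _+_ (sumFin-cong rows) (trans (sumBelow-cong m λ k _ → negativeImage-last-last w p r r<m k) (lastRowSum r r<m)) ⟩
    sumFin (g ∘ β w) + r          ≡⟨ cong (_+ r) (sumFin-injective (β w) inj g) ⟩
    sumFin g + r                  ≡⟨ cong (_+ r) (sumFin-threshold n (toℕ p) _ 1 (Finₚ.toℕ≤pred[n] p)) ⟩
    toℕ p * (m * indicator (not ⌊ r ≟ 0 ⌋)) + (n ∸ toℕ p) * 1 + r
      ≡⟨ cong (λ x → toℕ p * (m * indicator (not ⌊ r ≟ 0 ⌋)) + x + r) (*-identityʳ (n ∸ toℕ p)) ⟩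
    increment n (toℕ p) r         ∎
    where
    open ≡-Reasoning
    g : Fin n → ℕ
    g b = if ⌊ toℕ b <? toℕ p ⌋ then m * indicator (not ⌊ r ≟ 0 ⌋) else 1
    rows : ∀ l → sumBelow m (negativeImage (ins w p r) (Fin.fromℕ n) (Fin.inject₁ l)) ≡ g (β w l)
    rows l = trans (sumBelow-cong m λ k _ → negativeImage-last-inject₁ w p r r<m l k)
                   (rowSum ⌊ r ≟ 0 ⌋ ⌊ toℕ (β w l) <? toℕ p ⌋ (exponent w l))

  L-ins : ∀ {n} (w : Elt n) p r → r < m → Injective _≡_ _≡_ (β w) → L m (ins w p r) ≡ increment n (toℕ p) r + L m w
  L-ins {n} w p r r<m inj = begin
    L m (ins w p r)
      ≡⟨ L≡sum (ins w p r) ⟩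
    sumFin (λ j → sumFin λ l → sumBelow m (negativeImage (ins w p r) j l))
      ≡⟨ sumFin-last (λ j → sumFin λ l → sumBelow m (negativeImage (ins w p r) j l)) ⟩
    sumFin (λ j → sumFin λ l → sumBelow m (negativeImage (ins w p r) (Fin.inject₁ j) l))
      + sumFin (λ l → sumBelow m (negativeImage (ins w p r) (Fin.fromℕ n) l))
      ≡⟨ cong₂ _+_ (sumFin-cong oldRow) (lastColumnSum w p r r<m inj) ⟩
    sumFin (λ j → sumFin λ l → sumBelow m (negativeImage w j l)) + increment n (toℕ p) r
      ≡⟨ cong (_+ increment n (toℕ p) r) (L≡sum w) ⟨
    L m w + increment n (toℕ p) r
      ≡⟨ +-comm (L m w) _ ⟩
    increment n (toℕ p) r + L m w ∎
    where
    open ≡-Reasoning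
    oldRow : ∀ j → sumFin (λ l → sumBelow m (negativeImage (ins w p r) (Fin.inject₁ j) l)) ≡
                   sumFin (λ l → sumBelow m (negativeImage w j l))
    oldRow j = begin
      sumFin (λ l → sumBelow m (negativeImage (ins w p r) (Fin.inject₁ j) l))
        ≡⟨ sumFin-last (λ l → sumBelow m (negativeImage (ins w p r) (Fin.inject₁ j) l)) ⟩
      sumFin (λ l → sumBelow m (negativeImage (ins w p r) (Fin.inject₁ j) (Fin.inject₁ l)))
        + sumBelow m (negativeImage (ins w p r) (Fin.inject₁ j) (Fin.fromℕ n))
        ≡⟨ cong₂ _+_ (sumFin-cong λ l → sumBelow-cong m λ k _ → negativeImage-inject₁ w p r j l k)
                     (trans (sumBelow-cong m λ k _ → negativeImage-inject₁-last w p r j k) (trans (sumBelow-const m 0) (*-zeroʳ m))) ⟩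
      sumFin (λ l → sumBelow m (negativeImage w j l)) + 0
        ≡⟨ +-identityʳ _ ⟩
      sumFin (λ l → sumBelow m (negativeImage w j l)) ∎

  increment-zero : ∀ n t → increment n t 0 ≡ n ∸ t
  increment-zero n t = begin
    t * (m * 0) + (n ∸ t) + 0 ≡⟨ +-identityʳ _ ⟩
    t * (m * 0) + (n ∸ t)     ≡⟨ cong (λ x → t * x + (n ∸ t)) (*-zeroʳ m) ⟩
    t * 0 + (n ∸ t)           ≡⟨ cong (_+ (n ∸ t)) (*-zeroʳ t) ⟩
    n ∸ t                     ∎
    where open ≡-Reasoning

  increment-suc : ∀ n t r → t ≤ n → increment n t (suc r) ≡ n + (t * K + suc r)
  increment-suc n t r t≤n = begin
    t * (m * 1) + (n ∸ t) + suc r     ≡⟨ cong (λ x → t * x + (n ∸ t) + suc r) (*-identityʳ m) ⟩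
    t * suc K + (n ∸ t) + suc r       ≡⟨ cong (λ x → x + (n ∸ t) + suc r) (*-suc t K) ⟩
    t + t * K + (n ∸ t) + suc r       ≡⟨ regroup t (t * K) (n ∸ t) (suc r) ⟩
    (t + (n ∸ t)) + (t * K + suc r)   ≡⟨ cong (_+ (t * K + suc r)) (m+[n∸m]≡n t≤n) ⟩
    n + (t * K + suc r)               ∎
    where
    open ≡-Reasoning
    regroup : ∀ a b c d → a + b + c + d ≡ (a + c) + (b + d)
    regroup = solve-∀

  increment-zero<suc : ∀ {n} (p p′ : Fin (suc n)) r′ → increment n (toℕ p) 0 < increment n (toℕ p′) (suc r′)
  increment-zero<suc {n} p p′ r′ = begin-strict
    increment n (toℕ p) 0        ≡⟨ increment-zero n (toℕ p) ⟩
    n ∸ toℕ p                    ≤⟨ m∸n≤m n (toℕ p) ⟩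
    n                            <⟨ m<m+n n (≤-trans (s≤s z≤n) (m≤n+m (suc r′) (toℕ p′ * K))) ⟩
    n + (toℕ p′ * K + suc r′)    ≡⟨ increment-suc n (toℕ p′) r′ (Finₚ.toℕ≤pred[n] p′) ⟨
    increment n (toℕ p′) (suc r′) ∎
    where open ≤-Reasoning

  increment-injective : ∀ n (p p′ : Fin (suc n)) r r′ → r < m → r′ < m →
    increment n (toℕ p) r ≡ increment n (toℕ p′) r′ → p ≡ p′ × r ≡ r′
  increment-injective n p p′ zero    zero    _ _ eq = Finₚ.toℕ-injective (begin
    toℕ p               ≡⟨ m∸[m∸n]≡n (Finₚ.toℕ≤pred[n] p) ⟨
    n ∸ (n ∸ toℕ p)     ≡⟨ cong (n ∸_) (trans (sym (increment-zero n (toℕ p))) (trans eq (increment-zero n (toℕ p′)))) ⟩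
    n ∸ (n ∸ toℕ p′)    ≡⟨ m∸[m∸n]≡n (Finₚ.toℕ≤pred[n] p′) ⟩
    toℕ p′              ∎) , refl
    where open ≡-Reasoning
  increment-injective n p p′ zero    (suc r′) _ _ eq = ⊥-elim (<-irrefl eq (increment-zero<suc p p′ r′))
  increment-injective n p p′ (suc r) zero     _ _ eq = ⊥-elim (<-irrefl (sym eq) (increment-zero<suc p′ p r))
  increment-injective n p p′ (suc r) (suc r′) (s<s r<K) (s<s r′<K) eq =
    Finₚ.toℕ-injective t≡t′ , cong suc (+-cancelˡ-≡ (toℕ p * K) r r′ (trans tails (cong (λ t → t * K + r′) (sym t≡t′))))
    where
    tails : toℕ p * K + r ≡ toℕ p′ * K + r′
    tails = suc-injective (begin
      suc (toℕ p * K + r)   ≡⟨ +-suc (toℕ p * K) r ⟨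
      toℕ p * K + suc r     ≡⟨ +-cancelˡ-≡ n _ _ (trans (sym (increment-suc n (toℕ p) r (Finₚ.toℕ≤pred[n] p)))
                                                 (trans eq (increment-suc n (toℕ p′) r′ (Finₚ.toℕ≤pred[n] p′)))) ⟩
      toℕ p′ * K + suc r′   ≡⟨ +-suc (toℕ p′ * K) r′ ⟩
      suc (toℕ p′ * K + r′) ∎)
      where open ≡-Reasoning
    t≡t′ : toℕ p ≡ toℕ p′
    t≡t′ = *+-<-injective (toℕ p) (toℕ p′) r<K r′<K tails

  increment-< : ∀ n (p : Fin (suc n)) r → r < m → increment n (toℕ p) r < m * n + m
  increment-< n p zero    _         = begin-strict
    increment n (toℕ p) 0 ≡⟨ increment-zero n (toℕ p) ⟩
    n ∸ toℕ p             ≤⟨ m∸n≤m n (toℕ p) ⟩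
    n                     ≤⟨ m≤m+n n (K * n) ⟩
    m * n                 <⟨ m<m+n (m * n) z<s ⟩
    m * n + m             ∎
    where open ≤-Reasoning
  increment-< n p (suc r) (s<s r<K) = begin-strict
    increment n (toℕ p) (suc r) ≡⟨ increment-suc n (toℕ p) r (Finₚ.toℕ≤pred[n] p) ⟩
    n + (toℕ p * K + suc r)     <⟨ +-monoʳ-< n (+-mono-≤-< (*-monoˡ-≤ K (Finₚ.toℕ≤pred[n] p)) (s<s r<K)) ⟩
    n + (n * K + m)             ≡⟨ cong (λ x → n + (x + m)) (*-comm n K) ⟩
    n + (K * n + m)             ≡⟨ +-assoc n (K * n) m ⟨
    m * n + m                   ∎
    where open ≤-Reasoning

  incrementAt : ∀ n → Fin (suc n) × ℕ → ℕ
  incrementAt n (p , r) = increment n (toℕ p) r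

  -- The increments are injective on the m(n+1) letters and bounded by m(n+1).
  increments↭upTo : ∀ n → map (incrementAt n) (letters m (suc n)) ↭ upTo (m * n + m)
  increments↭upTo n = Unique-⊆-length⇒↭ _≟_ (Unique-map⁺-∈ (incrementAt n) inj (Unique-letters m (suc n))) (Unique.upTo⁺ _) sub
    (≤-reflexive (begin
      length (upTo (m * n + m))                         ≡⟨ length-upTo _ ⟩
      m * n + m                                         ≡⟨ trans (+-comm (m * n) m) (cong (m +_) (*-comm m n)) ⟩
      suc n * m                                         ≡⟨ cong (_* m) (length-tabulate {n = suc n} id) ⟨
      length (allFin (suc n)) * m                       ≡⟨ cong (length (allFin (suc n)) *_) (length-upTo m) ⟨
      length (allFin (suc n)) * length (upTo m)          ≡⟨ length-cartesianProductWith _,_ (allFin (suc n)) (upTo m) ⟨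
      length (letters m (suc n))                        ≡⟨ length-map (incrementAt n) (letters m (suc n)) ⟨
      length (map (incrementAt n) (letters m (suc n)))  ∎))
    where
    open ≡-Reasoning
    inj : ∀ {x y} → x ∈ letters m (suc n) → y ∈ letters m (suc n) → incrementAt n x ≡ incrementAt n y → x ≡ y
    inj {p , r} {p′ , r′} x∈ y∈ eq with increment-injective n p p′ r r′ (∈-letters⁻ x∈) (∈-letters⁻ y∈) eq
    ... | refl , refl = refl
    sub : map (incrementAt n) (letters m (suc n)) ⊆ upTo (m * n + m)
    sub {z} z∈ with ∈-map⁻ (incrementAt n) {xs = letters m (suc n)} z∈
    ... | pr , pr∈ , refl = ∈-upTo⁺ (increment-< n (proj₁ pr) (proj₂ pr) (∈-letters⁻ pr∈))

  insertAt : ∀ {n} → Fin (suc n) × ℕ → Elt n → Elt (suc n)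
  insertAt (p , r) w = ins w p r

  insertions↭G : ∀ n → cartesianProductWith insertAt (letters m (suc n)) (G m n) ↭ G m (suc n)
  insertions↭G n = Unique-⊆-⊇⇒↭ unique (Unique-G m (suc n)) sub sup
    where
    unique : Unique (cartesianProductWith insertAt (letters m (suc n)) (G m n))
    unique = Unique.cartesianProductWith⁺ insertAt ins-injective (Unique-letters m (suc n)) (Unique-G m n)
    sub : cartesianProductWith insertAt (letters m (suc n)) (G m n) ⊆ G m (suc n)
    sub w∈ with ∈-cartesianProductWith⁻ insertAt (letters m (suc n)) (G m n) w∈
    ... | (p , r) , w , pr∈ , w∈G , refl = InG⇒∈G (ins w p r) (ins-InG m w p r (∈-letters⁻ pr∈) (∈G⇒InG w∈G))
    sup : G m (suc n) ⊆ cartesianProductWith insertAt (letters m (suc n)) (G m n)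
    sup {w} w∈ = subst (_∈ _) D.ins-del
      (∈-cartesianProductWith⁺ insertAt (∈-letters (proj₁ w-InG (Fin.fromℕ n))) (InG⇒∈G D.del (D.del-InG m w-InG)))
      where
      w-InG = ∈G⇒InG w∈
      module D = Deletion w (proj₂ w-InG)

  L-↭-sums : ∀ n → map (L m) (G m n) ↭ sums m n
  L-↭-sums zero    = ↭-refl
  L-↭-sums (suc n) = begin
    map (L m) (G m (suc n))
      ↭⟨ ↭.map⁺ (L m) (insertions↭G n) ⟨
    map (L m) (cartesianProductWith insertAt (letters m (suc n)) (G m n))
      ≡⟨ map-cartesianProductWith (L m) insertAt (letters m (suc n)) (G m n) ⟩
    cartesianProductWith (λ pr w → L m (insertAt pr w)) (letters m (suc n)) (G m n)
      ≡⟨ cartesianProductWith-cong (letters m (suc n)) (G m n) L-insertAt ⟩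
    cartesianProductWith (λ pr w → incrementAt n pr + L m w) (letters m (suc n)) (G m n)
      ≡⟨ cartesianProductWith-mapʳ (λ pr l → incrementAt n pr + l) (L m) (letters m (suc n)) (G m n) ⟨
    cartesianProductWith (λ pr l → incrementAt n pr + l) (letters m (suc n)) (map (L m) (G m n))
      ≡⟨ cartesianProductWith-mapˡ _+_ (incrementAt n) (letters m (suc n)) (map (L m) (G m n)) ⟨
    cartesianProductWith _+_ (map (incrementAt n) (letters m (suc n))) (map (L m) (G m n))
      ↭⟨ cartesianProductWith-↭ _+_ (increments↭upTo n) (L-↭-sums n) ⟩
    sums m (suc n) ∎
    where
    open PermutationReasoning
    L-insertAt : ∀ {pr w} → pr ∈ letters m (suc n) → w ∈ G m n → L m (insertAt pr w) ≡ incrementAt n pr + L m w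
    L-insertAt {p , r} {w} pr∈ w∈ = L-ins w p r (∈-letters⁻ pr∈) (proj₂ (∈G⇒InG w∈))

-- The generators on positions

toℕ-up : ∀ {N} (j : Fin N) → suc (toℕ j) < N → toℕ (up j) ≡ suc (toℕ j)
toℕ-up {suc zero}    zero    (s<s ())
toℕ-up {suc (suc N)} zero    _         = refl
toℕ-up {suc (suc N)} (suc j) (s<s lt) = cong suc (toℕ-up j lt)

toℕ-pred : ∀ {N} (j : Fin N) → toℕ (Fin.pred j) ≡ toℕ j ∸ 1
toℕ-pred zero    = refl
toℕ-pred (suc j) = Finₚ.toℕ-inject₁ j

swapℕ : ℕ → ℕ → ℕ
swapℕ i t with t ≟ i | t ≟ suc i
... | yes _ | _     = suc i
... | no _  | yes _ = i
... | no _  | no _  = t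

toℕ-s : ∀ {N} i (j : Fin N) → suc i < N → toℕ (proj₁ (lookup (s {N} (suc i)) j)) ≡ swapℕ i (toℕ j)
toℕ-s i j i+1<N
  rewrite Vec.lookup∘tabulate (λ j → (if ⌊ toℕ j ≟ i ⌋ then up j else if ⌊ toℕ j ≟ suc i ⌋ then Fin.pred j else j) , 0) j
  with toℕ j ≟ i | toℕ j ≟ suc i
... | yes j≡i | _        = trans (toℕ-up j (subst (λ x → suc x < _) (sym j≡i) i+1<N)) (cong suc j≡i)
... | no _    | yes j≡i+1 = trans (toℕ-pred j) (cong (_∸ 1) j≡i+1)
... | no _    | no _      = refl

swapℕ-i : ∀ i → swapℕ i i ≡ suc i
swapℕ-i i with i ≟ i
... | yes _   = refl
... | no  i≢i = ⊥-elim (i≢i refl)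

swapℕ-suc : ∀ i → swapℕ i (suc i) ≡ i
swapℕ-suc i with suc i ≟ i | suc i ≟ suc i
... | yes eq | _      = ⊥-elim (<-irrefl (sym eq) ≤-refl)
... | no _   | yes _  = refl
... | no _   | no neq = ⊥-elim (neq refl)

swapℕ-other : ∀ i t → t ≢ i → t ≢ suc i → swapℕ i t ≡ t
swapℕ-other i t t≢i t≢i+1 with t ≟ i | t ≟ suc i
... | yes eq | _      = ⊥-elim (t≢i eq)
... | no _   | yes eq = ⊥-elim (t≢i+1 eq)
... | no _   | no _   = refl

-- The cycle 0 ↦ i ↦ i − 1 ↦ ⋯ ↦ 1 ↦ 0 of σ_i on 0-based positions.
cycleℕ : ℕ → ℕ → ℕ
cycleℕ i zero    = i
cycleℕ i (suc t) with suc t ≤? i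
... | yes _ = t
... | no _  = suc t

cycleℕ-≤ : ∀ i t → suc t ≤ i → cycleℕ i (suc t) ≡ t
cycleℕ-≤ i t t<i with suc t ≤? i
... | yes _   = refl
... | no  t≮i = ⊥-elim (t≮i t<i)

cycleℕ-> : ∀ i t → ¬ (suc t ≤ i) → cycleℕ i (suc t) ≡ suc t
cycleℕ-> i t t≮i with suc t ≤? i
... | yes t<i = ⊥-elim (t≮i t<i)
... | no _    = refl

cycleℕ-zero : ∀ t → cycleℕ 0 t ≡ t
cycleℕ-zero zero    = refl
cycleℕ-zero (suc t) = cycleℕ-> 0 t λ ()

swapℕ-cycleℕ : ∀ i t → swapℕ i (cycleℕ i t) ≡ cycleℕ (suc i) t
swapℕ-cycleℕ i zero = swapℕ-i i
swapℕ-cycleℕ i (suc t) with suc t ≤? i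
... | yes t<i = trans (swapℕ-other i t (<⇒≢ t<i) (λ t≡i+1 → <-irrefl refl (≤-trans (subst (λ x → suc x ≤ i) t≡i+1 t<i) (n≤1+n i))))
                      (sym (cycleℕ-≤ (suc i) t (m≤n⇒m≤1+n t<i)))
... | no  t≮i with t ≟ i
...   | yes refl = trans (swapℕ-suc t) (sym (cycleℕ-≤ (suc t) t ≤-refl))
...   | no  t≢i  = trans (swapℕ-other i (suc t) (t≮i ∘ ≤-reflexive) (t≢i ∘ suc-injective))
                         (sym (cycleℕ-> (suc i) t (λ t<i+1 → t≮i (≤∧≢⇒< (≤-pred t<i+1) t≢i))))

cycleℕ-injective : ∀ i a b → cycleℕ i a ≡ cycleℕ i b → a ≡ b
cycleℕ-injective i zero    zero    eq = refl
cycleℕ-injective i zero    (suc b) eq with suc b ≤? i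
... | yes b<i = ⊥-elim (<-irrefl (sym eq) b<i)
... | no  b≮i = ⊥-elim (b≮i (≤-reflexive (sym eq)))
cycleℕ-injective i (suc a) zero    eq with suc a ≤? i
... | yes a<i = ⊥-elim (<-irrefl eq a<i)
... | no  a≮i = ⊥-elim (a≮i (≤-reflexive eq))
cycleℕ-injective i (suc a) (suc b) eq with suc a ≤? i | suc b ≤? i
... | yes _   | yes _   = cong suc eq
... | yes a<i | no  b≮i = ⊥-elim (b≮i (≤-trans (n≤1+n (suc b)) (subst (λ x → suc x ≤ i) eq a<i)))
... | no  a≮i | yes b<i = ⊥-elim (a≮i (≤-trans (n≤1+n (suc a)) (subst (λ x → suc x ≤ i) (sym eq) b<i)))
... | no  _   | no  _   = eq

module FlagMajor (K : ℕ) where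

  open Length K using (L-↭-sums)

  private
    m : ℕ
    m = suc K

  %-absorbʳ : ∀ x y → (x + y % m) % m ≡ (x + y) % m
  %-absorbʳ x y = trans (%-distribˡ-+ x (y % m) m)
    (trans (cong (λ t → (x % m + t) % m) (m%n%n≡m%n y m)) (sym (%-distribˡ-+ x y m)))

  %-absorbˡ : ∀ x y → (x % m + y) % m ≡ (x + y) % m
  %-absorbˡ x y = trans (cong (_% m) (+-comm (x % m) y)) (trans (%-absorbʳ y x) (cong (_% m) (+-comm y x)))

  +-%-cancelʳ : ∀ a b c → a < m → b < m → (a + c) % m ≡ (b + c) % m → a ≡ b
  +-%-cancelʳ a b c a<m b<m eq = trans (sym (undo a a<m)) (trans (cong (λ t → (t + c′) % m) eq) (undo b b<m))
    where
    c′ : ℕ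
    c′ = c * m ∸ c
    undo : ∀ a → a < m → ((a + c) % m + c′) % m ≡ a
    undo a a<m = begin
      ((a + c) % m + c′) % m ≡⟨ %-absorbˡ (a + c) c′ ⟩
      (a + c + c′) % m       ≡⟨ cong (_% m) (trans (+-assoc a c c′) (cong (a +_) (m+[n∸m]≡n (m≤m*n c m)))) ⟩
      (a + c * m) % m        ≡⟨ [m+kn]%n≡m%n a c m ⟩
      a % m                  ≡⟨ m<n⇒m%n≡m a<m ⟩
      a                      ∎
      where open ≡-Reasoning

  lookup-mul : ∀ {n} (v w : Elt n) j → lookup (mul m v w) j ≡ act m v (lookup w j)
  lookup-mul v w = Vec.lookup∘tabulate _

  act-mul : ∀ {n} (u v : Elt n) x → act m (mul m u v) x ≡ act m u (act m v x)
  act-mul u v (p , a) = trans (cong (λ y → proj₁ y , (a + proj₂ y) % m) (lookup-mul u v p))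
    (cong (β u (β v p) ,_) (begin
      (a + (exponent v p + exponent u (β v p)) % m) % m ≡⟨ %-absorbʳ a _ ⟩
      (a + (exponent v p + exponent u (β v p))) % m     ≡⟨ cong (_% m) (+-assoc a _ _) ⟨
      (a + exponent v p + exponent u (β v p)) % m       ≡⟨ %-absorbˡ (a + exponent v p) _ ⟨
      ((a + exponent v p) % m + exponent u (β v p)) % m ∎))
    where open ≡-Reasoning

  mul-assoc : ∀ {n} (u v w : Elt n) → mul m u (mul m v w) ≡ mul m (mul m u v) w
  mul-assoc u v w = lookup-ext λ j → begin
    lookup (mul m u (mul m v w)) j ≡⟨ lookup-mul u (mul m v w) j ⟩
    act m u (lookup (mul m v w) j) ≡⟨ cong (act m u) (lookup-mul v w j) ⟩
    act m u (act m v (lookup w j)) ≡⟨ act-mul u v (lookup w j) ⟨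
    act m (mul m u v) (lookup w j) ≡⟨ lookup-mul (mul m u v) w j ⟨
    lookup (mul m (mul m u v) w) j ∎
    where open ≡-Reasoning

  lookup-identity : ∀ {n} (j : Fin n) → lookup identity j ≡ (j , 0)
  lookup-identity = Vec.lookup∘tabulate _

  mul-identityˡ : ∀ {n} (w : Elt n) → Reduced m w → mul m identity w ≡ w
  mul-identityˡ w reduced = lookup-ext λ j → trans (lookup-mul identity w j)
    (trans (cong (λ y → proj₁ y , (exponent w j + proj₂ y) % m) (lookup-identity (β w j)))
           (cong (β w j ,_) (trans (cong (_% m) (+-identityʳ (exponent w j))) (m<n⇒m%n≡m (reduced j)))))

  mul-identityʳ : ∀ {n} (w : Elt n) → Reduced m w → mul m w identity ≡ w
  mul-identityʳ w reduced = lookup-ext λ j → trans (lookup-mul w identity j)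
    (trans (cong (act m w) (lookup-identity j)) (cong (β w j ,_) (m<n⇒m%n≡m (reduced j))))

  Reduced-mul : ∀ {n} (u v : Elt n) → Reduced m (mul m u v)
  Reduced-mul u v j = subst (λ y → proj₂ y < m) (sym (lookup-mul u v j)) (m%n<n (exponent v j + exponent u (β v j)) m)

  Reduced-power : ∀ {n} (u : Elt n) k → Reduced m (power m u k)
  Reduced-power u zero    j = subst (λ y → proj₂ y < m) (sym (lookup-identity j)) z<s
  Reduced-power u (suc k)   = Reduced-mul u (power m u k)

  InG-mul : ∀ {n} (u v : Elt n) → InG m u → InG m v → InG m (mul m u v)
  InG-mul u v (_ , u-inj) (_ , v-inj) = Reduced-mul u v , λ eq →
    v-inj (u-inj (trans (sym (cong proj₁ (lookup-mul u v _))) (trans eq (cong proj₁ (lookup-mul u v _)))))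

  InG-identity : ∀ {n} → InG m (identity {n})
  InG-identity = Reduced-power identity 0 ,
    λ eq → trans (sym (cong proj₁ (lookup-identity _))) (trans eq (cong proj₁ (lookup-identity _)))

  InG-power : ∀ {n} (u : Elt n) k → InG m u → InG m (power m u k)
  InG-power u zero    _   = InG-identity
  InG-power u (suc k) u∈G = InG-mul u (power m u k) u∈G (InG-power u k u∈G)

  mul-cancelˡ : ∀ {n} (v a b : Elt n) → Injective _≡_ _≡_ (β v) → Reduced m a → Reduced m b →
    mul m v a ≡ mul m v b → a ≡ b
  mul-cancelˡ v a b v-inj a-reduced b-reduced eq = lookup-ext λ j →
    let eqj = trans (sym (lookup-mul v a j)) (trans (cong (λ z → lookup z j) eq) (lookup-mul v b j))
        β≡  = v-inj (cong proj₁ eqj)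
    in cong₂ _,_ β≡ (+-%-cancelʳ _ _ _ (a-reduced j) (b-reduced j)
         (trans (cong proj₂ eqj) (cong (λ p → (exponent b j + exponent v p) % m) (sym β≡))))

  lookup-power : ∀ {n} (v : Elt n) k j → lookup (power m v k) j ≡ (act m v ^ k) (j , 0)
  lookup-power v zero    j = lookup-identity j
  lookup-power v (suc k) j = trans (lookup-mul v (power m v k) j) (cong (act m v) (lookup-power v k j))

  punchIn-fromℕ : ∀ n (j : Fin n) → Fin.punchIn (Fin.fromℕ n) j ≡ Fin.inject₁ j
  punchIn-fromℕ (suc n) zero    = refl
  punchIn-fromℕ (suc n) (suc j) = cong suc (punchIn-fromℕ n j)

  embed : ∀ {n} → Elt n → Elt (suc n)
  embed {n} w = ins w (Fin.fromℕ n) 0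

  lookup-embed-inject₁ : ∀ {n} (w : Elt n) j → lookup (embed w) (Fin.inject₁ j) ≡ (Fin.inject₁ (β w j) , exponent w j)
  lookup-embed-inject₁ {n} w j = trans (lookup-ins-inject₁ w (Fin.fromℕ n) 0 j) (cong (_, exponent w j) (punchIn-fromℕ n (β w j)))

  lookup-embed-last : ∀ {n} (w : Elt n) → lookup (embed w) (Fin.fromℕ n) ≡ (Fin.fromℕ n , 0)
  lookup-embed-last {n} w = lookup-ins-last w (Fin.fromℕ n) 0

  embed-injective : ∀ {n} {u v : Elt n} → embed u ≡ embed v → u ≡ v
  embed-injective = proj₂ ∘ ins-injective

  embed-mul : ∀ {n} (u v : Elt n) → embed (mul m u v) ≡ mul m (embed u) (embed v)
  embed-mul {n} u v = lookup-ext λ j → at (lastOrInject₁ j)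
    where
    at : ∀ {j} → j ≡ Fin.fromℕ n ⊎ ∃ (λ i → j ≡ Fin.inject₁ i) → lookup (embed (mul m u v)) j ≡ lookup (mul m (embed u) (embed v)) j
    at (inj₁ refl) = trans (lookup-embed-last (mul m u v)) (sym (trans (lookup-mul (embed u) (embed v) (Fin.fromℕ n))
      (trans (cong (act m (embed u)) (lookup-embed-last v)) (cong (λ y → proj₁ y , (0 + proj₂ y) % m) (lookup-embed-last u)))))
    at (inj₂ (i , refl)) = trans (lookup-embed-inject₁ (mul m u v) i)
      (trans (cong (λ y → Fin.inject₁ (proj₁ y) , proj₂ y) (lookup-mul u v i))
      (sym (trans (lookup-mul (embed u) (embed v) (Fin.inject₁ i))
           (trans (cong (act m (embed u)) (lookup-embed-inject₁ v i))
                  (cong (λ y → proj₁ y , (exponent v i + proj₂ y) % m) (lookup-embed-inject₁ u (β v i)))))))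

  embed-identity : ∀ {n} → embed (identity {n}) ≡ identity
  embed-identity {n} = lookup-ext λ j → at (lastOrInject₁ j)
    where
    at : ∀ {j} → j ≡ Fin.fromℕ n ⊎ ∃ (λ i → j ≡ Fin.inject₁ i) → lookup (embed (identity {n})) j ≡ lookup identity j
    at (inj₁ refl)       = trans (lookup-embed-last identity) (sym (lookup-identity (Fin.fromℕ n)))
    at (inj₂ (i , refl)) = trans (lookup-embed-inject₁ identity i)
      (trans (cong (λ y → Fin.inject₁ (proj₁ y) , proj₂ y) (lookup-identity i)) (sym (lookup-identity (Fin.inject₁ i))))

  embed-power : ∀ {n} (u : Elt n) k → embed (power m u k) ≡ power m (embed u) k
  embed-power u zero    = embed-identity
  embed-power u (suc k) = trans (embed-mul u (power m u k)) (cong (mul m (embed u)) (embed-power u k))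

  -- σ_i sends the letter 1 to ε (i+1) and j+1 to j for j ≤ i.
  σ-exponent : ℕ → ℕ
  σ-exponent zero    = 1 % m
  σ-exponent (suc t) = 0

  σ-exponent<m : ∀ t → σ-exponent t < m
  σ-exponent<m zero    = m%n<n 1 m
  σ-exponent<m (suc t) = z<s

  lookup-σ : ∀ {N} i (j : Fin N) → i < N →
    toℕ (β (σ m {N} i) j) ≡ cycleℕ i (toℕ j) × exponent (σ m {N} i) j ≡ σ-exponent (toℕ j)
  lookup-σ zero j _ rewrite Vec.lookup∘tabulate (λ j → j , (if ⌊ toℕ j ≟ 0 ⌋ then modN m 1 else 0)) j =
    sym (cycleℕ-zero (toℕ j)) , t₁-exponent (toℕ j)
    where
    t₁-exponent : ∀ t → (if ⌊ t ≟ 0 ⌋ then modN m 1 else 0) ≡ σ-exponent t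
    t₁-exponent zero    = refl
    t₁-exponent (suc t) = refl
  lookup-σ {N} (suc i) j i+1<N with lookup-σ {N} i j (<-trans (n<1+n i) i+1<N)
  ... | β≡ , exponent≡ =
    trans (cong (toℕ ∘ proj₁) (lookup-mul (s (suc i)) (σ m i) j))
      (trans (toℕ-s i (β (σ m i) j) i+1<N) (trans (cong (swapℕ i) β≡) (swapℕ-cycleℕ i (toℕ j)))) ,
    trans (cong proj₂ (lookup-mul (s (suc i)) (σ m i) j))
      (trans (cong (λ y → (exponent (σ m i) j + proj₂ y) % m) (Vec.lookup∘tabulate _ (β (σ m i) j)))
        (trans (cong (λ x → (x + 0) % m) exponent≡) (exponent-reduced (toℕ j))))
    where
    exponent-reduced : ∀ t → (σ-exponent t + 0) % m ≡ σ-exponent t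
    exponent-reduced t = trans (cong (_% m) (+-identityʳ (σ-exponent t))) (m<n⇒m%n≡m (σ-exponent<m t))

  σ-InG : ∀ {N} i → i < N → InG m (σ m {N} i)
  σ-InG i i<N = (λ j → subst (_< m) (sym (proj₂ (lookup-σ i j i<N))) (σ-exponent<m (toℕ j))) ,
    λ {a} {b} eq → Finₚ.toℕ-injective (cycleℕ-injective i (toℕ a) (toℕ b)
       (trans (sym (proj₁ (lookup-σ i a i<N))) (trans (cong toℕ eq) (proj₁ (lookup-σ i b i<N)))))

  embed-σ : ∀ {n} i → i < n → embed (σ m {n} i) ≡ σ m {suc n} i
  embed-σ {n@(suc _)} i i<n = lookup-ext λ j → at (lastOrInject₁ j)
    where
    i<n+1 = m≤n⇒m≤1+n i<n
    at : ∀ {j} → j ≡ Fin.fromℕ n ⊎ ∃ (λ k → j ≡ Fin.inject₁ k) → lookup (embed (σ m i)) j ≡ lookup (σ m {suc n} i) j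
    at (inj₁ refl) = trans (lookup-embed-last (σ m i)) (sym (×-≡,≡→≡ (
      Finₚ.toℕ-injective (begin
        toℕ (β (σ m i) (Fin.fromℕ n)) ≡⟨ proj₁ (lookup-σ i (Fin.fromℕ n) i<n+1) ⟩
        cycleℕ i (toℕ (Fin.fromℕ n))  ≡⟨ cong (cycleℕ i) (Finₚ.toℕ-fromℕ n) ⟩
        cycleℕ i n                     ≡⟨ fixed n i<n ⟩
        n                              ≡⟨ Finₚ.toℕ-fromℕ n ⟨
        toℕ (Fin.fromℕ n)             ∎) ,
      trans (proj₂ (lookup-σ i (Fin.fromℕ n) i<n+1)) (cong σ-exponent (Finₚ.toℕ-fromℕ n)))))
      where
      open ≡-Reasoning
      fixed : ∀ n → i < n → cycleℕ i n ≡ n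
      fixed (suc n) i<n+1 = cycleℕ-> i n (λ n<i → <-irrefl refl (≤-trans i<n+1 n<i))
    at (inj₂ (k , refl)) = trans (lookup-embed-inject₁ (σ m i) k) (sym (×-≡,≡→≡ (
      Finₚ.toℕ-injective (trans (proj₁ (lookup-σ i (Fin.inject₁ k) i<n+1))
        (trans (cong (cycleℕ i) (Finₚ.toℕ-inject₁ k)) (trans (sym (proj₁ (lookup-σ i k i<n))) (sym (Finₚ.toℕ-inject₁ _))))) ,
      trans (proj₂ (lookup-σ i (Fin.inject₁ k) i<n+1)) (trans (cong σ-exponent (Finₚ.toℕ-inject₁ k)) (sym (proj₂ (lookup-σ i k i<n)))))))

  -- On 0-based positions σ_n moves the last letter n through n ↦ n − 1 ↦ ⋯ ↦ 0 ↦ ε n, so the first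
  -- m(n+1) powers of σ_n send it to distinct coloured letters.
  stepσ : ∀ n → Fin (suc n) × ℕ → Fin (suc n) × ℕ
  stepσ n = act m (σ m {suc n} n)

  stepσ-spec : ∀ n (x : Fin (suc n) × ℕ) →
    toℕ (proj₁ (stepσ n x)) ≡ cycleℕ n (toℕ (proj₁ x)) × proj₂ (stepσ n x) ≡ (proj₂ x + σ-exponent (toℕ (proj₁ x))) % m
  stepσ-spec n (p , a) = proj₁ (lookup-σ n p ≤-refl) , cong (λ y → (a + y) % m) (proj₂ (lookup-σ n p ≤-refl))

  orbit-descend : ∀ n t a → t ≤ n → a < m →
    toℕ (proj₁ ((stepσ n ^ t) (Fin.fromℕ n , a))) ≡ n ∸ t × proj₂ ((stepσ n ^ t) (Fin.fromℕ n , a)) ≡ a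
  orbit-descend n zero    a _   _   = Finₚ.toℕ-fromℕ n , refl
  orbit-descend n (suc t) a t<n a<m with orbit-descend n t a (<⇒≤ t<n) a<m | stepσ-spec n ((stepσ n ^ t) (Fin.fromℕ n , a))
  ... | β≡ , a≡ | β′≡ , a′≡ =
    trans β′≡ (trans (cong (cycleℕ n) (trans β≡ n∸t≡)) (cycleℕ-≤ n (n ∸ suc t) (≤-trans (≤-reflexive (sym n∸t≡)) (m∸n≤m n t)))) ,
    trans a′≡ (trans (cong₂ (λ x y → (x + σ-exponent y) % m) a≡ (trans β≡ n∸t≡))
                     (trans (cong (_% m) (+-identityʳ a)) (m<n⇒m%n≡m a<m)))
    where
    n∸t≡ : n ∸ t ≡ suc (n ∸ suc t)
    n∸t≡ = +-∸-assoc 1 t<n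

  orbit-round : ∀ n a → a < m → (stepσ n ^ suc n) (Fin.fromℕ n , a) ≡ (Fin.fromℕ n , (a + 1) % m)
  orbit-round n a a<m with orbit-descend n n a ≤-refl a<m | stepσ-spec n ((stepσ n ^ n) (Fin.fromℕ n , a))
  ... | β≡ , a≡ | β′≡ , a′≡ = ×-≡,≡→≡
    (Finₚ.toℕ-injective (trans β′≡ (trans (cong (cycleℕ n) (trans β≡ (n∸n≡0 n))) (sym (Finₚ.toℕ-fromℕ n)))) ,
     trans a′≡ (trans (cong₂ (λ x y → (x + σ-exponent y) % m) a≡ (trans β≡ (n∸n≡0 n))) (%-absorbʳ a 1)))

  orbit-rounds : ∀ n q → (stepσ n ^ (q * suc n)) (Fin.fromℕ n , 0) ≡ (Fin.fromℕ n , q % m)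
  orbit-rounds n zero    = refl
  orbit-rounds n (suc q) = begin
    (stepσ n ^ (suc n + q * suc n)) (Fin.fromℕ n , 0)          ≡⟨ cong-app (^-homo (stepσ n) (suc n) (q * suc n)) _ ⟩
    (stepσ n ^ suc n) ((stepσ n ^ (q * suc n)) (Fin.fromℕ n , 0)) ≡⟨ cong (stepσ n ^ suc n) (orbit-rounds n q) ⟩
    (stepσ n ^ suc n) (Fin.fromℕ n , q % m)                     ≡⟨ orbit-round n (q % m) (m%n<n q m) ⟩
    (Fin.fromℕ n , (q % m + 1) % m)                             ≡⟨ cong (Fin.fromℕ n ,_) (trans (%-absorbˡ q 1) (cong (_% m) (+-comm q 1))) ⟩
    (Fin.fromℕ n , suc q % m)                                   ∎
    where open ≡-Reasoning

  orbit : ∀ n k → k < m * n + m →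
    toℕ (proj₁ ((stepσ n ^ k) (Fin.fromℕ n , 0))) ≡ n ∸ k % suc n × proj₂ ((stepσ n ^ k) (Fin.fromℕ n , 0)) ≡ k / suc n
  orbit n k k<m[n+1] =
    trans (cong (toℕ ∘ proj₁) k-split) (proj₁ descend) , trans (cong proj₂ k-split) (trans (proj₂ descend) rounds<m)
    where
    rounds<m : (k / suc n) % m ≡ k / suc n
    rounds<m = m<n⇒m%n≡m (m<n*o⇒m/o<n (subst (k <_) (trans (+-comm (m * n) m) (sym (*-suc m n))) k<m[n+1]))
    descend = orbit-descend n (k % suc n) ((k / suc n) % m) (≤-pred (m%n<n k (suc n))) (m%n<n (k / suc n) m)
    k-split : (stepσ n ^ k) (Fin.fromℕ n , 0) ≡ (stepσ n ^ (k % suc n)) (Fin.fromℕ n , (k / suc n) % m)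
    k-split = begin
      (stepσ n ^ k) (Fin.fromℕ n , 0)
        ≡⟨ cong (λ x → (stepσ n ^ x) (Fin.fromℕ n , 0)) (m≡m%n+[m/n]*n k (suc n)) ⟩
      (stepσ n ^ (k % suc n + k / suc n * suc n)) (Fin.fromℕ n , 0)
        ≡⟨ cong-app (^-homo (stepσ n) (k % suc n) _) _ ⟩
      (stepσ n ^ (k % suc n)) ((stepσ n ^ (k / suc n * suc n)) (Fin.fromℕ n , 0))
        ≡⟨ cong (stepσ n ^ (k % suc n)) (orbit-rounds n (k / suc n)) ⟩
      (stepσ n ^ (k % suc n)) (Fin.fromℕ n , (k / suc n) % m) ∎
      where open ≡-Reasoning

  power-σ-last-injective : ∀ n k k′ → k < m * n + m → k′ < m * n + m →
    lookup (power m (σ m {suc n} n) k) (Fin.fromℕ n) ≡ lookup (power m (σ m {suc n} n) k′) (Fin.fromℕ n) → k ≡ k′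
  power-σ-last-injective n k k′ k< k′< eq = begin
    k                                ≡⟨ m≡m%n+[m/n]*n k (suc n) ⟩
    k % suc n + k / suc n * suc n    ≡⟨ cong₂ (λ a b → a + b * suc n) remainders quotients ⟩
    k′ % suc n + k′ / suc n * suc n  ≡⟨ m≡m%n+[m/n]*n k′ (suc n) ⟨
    k′                               ∎
    where
    open ≡-Reasoning
    orbit≡ : (stepσ n ^ k) (Fin.fromℕ n , 0) ≡ (stepσ n ^ k′) (Fin.fromℕ n , 0)
    orbit≡ = trans (sym (lookup-power (σ m n) k (Fin.fromℕ n))) (trans eq (lookup-power (σ m n) k′ (Fin.fromℕ n)))
    remainders : k % suc n ≡ k′ % suc n
    remainders = trans (sym (m∸[m∸n]≡n (≤-pred (m%n<n k (suc n)))))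
      (trans (cong (n ∸_) (trans (sym (proj₁ (orbit n k k<))) (trans (cong (toℕ ∘ proj₁) orbit≡) (proj₁ (orbit n k′ k′<)))))
             (m∸[m∸n]≡n (≤-pred (m%n<n k′ (suc n)))))
    quotients : k / suc n ≡ k′ / suc n
    quotients = trans (sym (proj₂ (orbit n k k<))) (trans (cong proj₂ orbit≡) (proj₂ (orbit n k′ k′<)))

  head-index< : ∀ {n} i k (ks : List ℕ) → i + length (k ∷ ks) ≤ n → i < n
  head-index< {n} i k ks fits = ≤-trans (s≤s (m≤m+n i (length ks))) (subst (_≤ n) (+-suc i (length ks)) fits)

  tuples-suc : ∀ i c → tuples m i (suc c) ≡ cartesianProductWith _∷_ (upTo (m * i + m)) (tuples m (suc i) c)
  tuples-suc i c = concatMap-map _∷_ (upTo (m * i + m)) (tuples m (suc i) c)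

  ∈-tuples-suc⁻ : ∀ {i c ks} → ks ∈ tuples m i (suc c) →
    ∃₂ λ k ks′ → k < m * i + m × ks′ ∈ tuples m (suc i) c × ks ≡ k ∷ ks′
  ∈-tuples-suc⁻ {i} {c} ks∈
    with ∈-cartesianProductWith⁻ _∷_ (upTo (m * i + m)) (tuples m (suc i) c) (subst (_ ∈_) (tuples-suc i c) ks∈)
  ... | k , ks′ , k∈ , ks′∈ , eq = k , ks′ , ∈-upTo⁻ k∈ , ks′∈ , eq

  ∈-tuples-suc⁺ : ∀ {i c k ks′} → k < m * i + m → ks′ ∈ tuples m (suc i) c → k ∷ ks′ ∈ tuples m i (suc c)
  ∈-tuples-suc⁺ {i} {c} k< ks′∈ = subst (_ ∈_) (sym (tuples-suc i c)) (∈-cartesianProductWith⁺ _∷_ (∈-upTo⁺ k<) ks′∈)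

  Unique-tuples : ∀ i c → Unique (tuples m i c)
  Unique-tuples i zero    = [] ∷ []
  Unique-tuples i (suc c) = subst Unique (sym (tuples-suc i c))
    (Unique.cartesianProductWith⁺ _∷_ (λ eq → ∷-injectiveˡ eq , ∷-injectiveʳ eq) (Unique.upTo⁺ (m * i + m)) (Unique-tuples (suc i) c))

  length-∈-tuples : ∀ i c {ks} → ks ∈ tuples m i c → length ks ≡ c
  length-∈-tuples i zero    (here refl) = refl
  length-∈-tuples i (suc c) ks∈ with ∈-tuples-suc⁻ {i} {c} ks∈
  ... | _ , _ , _ , ks′∈ , refl = cong suc (length-∈-tuples (suc i) c ks′∈)

  ∈-tuples-snoc⁻ : ∀ i c {ks} → ks ∈ tuples m i (suc c) →
    ∃₂ λ ks′ k → ks ≡ ks′ ++ k ∷ [] × ks′ ∈ tuples m i c × k < m * (i + c) + m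
  ∈-tuples-snoc⁻ i zero ks∈ with ∈-tuples-suc⁻ {i} {0} ks∈
  ... | k , .[] , k< , here refl , refl = [] , k , refl , here refl , subst (λ x → k < m * x + m) (sym (+-identityʳ i)) k<
  ∈-tuples-snoc⁻ i (suc c) ks∈ with ∈-tuples-suc⁻ {i} {suc c} ks∈
  ... | k₀ , ks₀ , k₀< , ks₀∈ , refl with ∈-tuples-snoc⁻ (suc i) c ks₀∈
  ...   | ks′ , k , refl , ks′∈ , k< =
    k₀ ∷ ks′ , k , refl , ∈-tuples-suc⁺ {i} {c} k₀< ks′∈ , subst (λ x → k < m * x + m) (sym (+-suc i c)) k<

  ∈-tuples-snoc⁺ : ∀ i c {ks′ k} → ks′ ∈ tuples m i c → k < m * (i + c) + m → ks′ ++ k ∷ [] ∈ tuples m i (suc c)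
  ∈-tuples-snoc⁺ i zero    {k = k} (here refl) k< = ∈-tuples-suc⁺ {i} {0} (subst (λ x → k < m * x + m) (+-identityʳ i) k<) (here refl)
  ∈-tuples-snoc⁺ i (suc c) {k = k} ks′∈ k< with ∈-tuples-suc⁻ {i} {c} ks′∈
  ... | k₀ , ks₀ , k₀< , ks₀∈ , refl =
    ∈-tuples-suc⁺ {i} {suc c} k₀< (∈-tuples-snoc⁺ (suc i) c ks₀∈ (subst (λ x → k < m * x + m) (+-suc i c) k<))

  tupleProd-snoc : ∀ {n} i ks k → tupleProd m {n} i (ks ++ k ∷ []) ≡ mul m (power m (σ m (i + length ks)) k) (tupleProd m i ks)
  tupleProd-snoc i [] k = begin
    mul m identity (power m (σ m i) k)         ≡⟨ mul-identityˡ (power m (σ m i) k) (Reduced-power (σ m i) k) ⟩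
    power m (σ m i) k                          ≡⟨ cong (λ x → power m (σ m x) k) (+-identityʳ i) ⟨
    power m (σ m (i + 0)) k                    ≡⟨ mul-identityʳ (power m (σ m (i + 0)) k) (Reduced-power (σ m (i + 0)) k) ⟨
    mul m (power m (σ m (i + 0)) k) identity   ∎
    where open ≡-Reasoning
  tupleProd-snoc i (k₀ ∷ ks) k = begin
    mul m (tupleProd m (suc i) (ks ++ k ∷ [])) (power m (σ m i) k₀)
      ≡⟨ cong (λ x → mul m x (power m (σ m i) k₀)) (tupleProd-snoc (suc i) ks k) ⟩
    mul m (mul m (power m (σ m (suc i + length ks)) k) (tupleProd m (suc i) ks)) (power m (σ m i) k₀)
      ≡⟨ mul-assoc (power m (σ m (suc i + length ks)) k) (tupleProd m (suc i) ks) (power m (σ m i) k₀) ⟨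
    mul m (power m (σ m (suc i + length ks)) k) (tupleProd m i (k₀ ∷ ks))
      ≡⟨ cong (λ x → mul m (power m (σ m x) k) (tupleProd m i (k₀ ∷ ks))) (+-suc i (length ks)) ⟨
    mul m (power m (σ m (i + length (k₀ ∷ ks))) k) (tupleProd m i (k₀ ∷ ks)) ∎
    where open ≡-Reasoning

  tupleProd-embed : ∀ {n} i ks → i + length ks ≤ n → embed (tupleProd m {n} i ks) ≡ tupleProd m {suc n} i ks
  tupleProd-embed i []       _    = embed-identity
  tupleProd-embed {n} i (k ∷ ks) fits = trans (embed-mul (tupleProd m (suc i) ks) (power m (σ m i) k))
    (cong₂ (mul m) (tupleProd-embed (suc i) ks (subst (_≤ n) (+-suc i (length ks)) fits))
                   (trans (embed-power (σ m i) k) (cong (λ x → power m x k) (embed-σ i (head-index< i k ks fits)))))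

  tupleProd-InG : ∀ {n} i ks → i + length ks ≤ n → InG m (tupleProd m {n} i ks)
  tupleProd-InG i []       _    = InG-identity
  tupleProd-InG {n} i (k ∷ ks) fits = InG-mul (tupleProd m (suc i) ks) (power m (σ m i) k)
    (tupleProd-InG (suc i) ks (subst (_≤ n) (+-suc i (length ks)) fits)) (InG-power (σ m i) k (σ-InG i (head-index< i k ks fits)))

  -- The last exponent is read off the image of the last letter, which σ_0, …, σ_{n-1} fix;
  -- cancelling σ_n^k then leaves an element of G(m,1,n).
  tupleProd-injective : ∀ n {ks ks′} → ks ∈ tuples m 0 n → ks′ ∈ tuples m 0 n →
    tupleProd m {n} 0 ks ≡ tupleProd m 0 ks′ → ks ≡ ks′
  tupleProd-injective zero    (here refl) (here refl) _ = refl
  tupleProd-injective (suc n) ks∈ ks′∈ eq with ∈-tuples-snoc⁻ 0 n ks∈ | ∈-tuples-snoc⁻ 0 n ks′∈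
  ... | as , k , refl , as∈ , k< | as′ , k′ , refl , as′∈ , k′< = cong₂ (λ as k → as ++ k ∷ []) as≡as′ k≡k′
    where
    P : ℕ → Elt (suc n)
    P k = power m (σ m {suc n} n) k
    split : ∀ as k → length as ≡ n → tupleProd m {suc n} 0 (as ++ k ∷ []) ≡ mul m (P k) (embed (tupleProd m {n} 0 as))
    split as k len = trans (tupleProd-snoc 0 as k)
      (cong₂ (λ x y → mul m (power m (σ m x) k) y) len (sym (tupleProd-embed 0 as (≤-reflexive len))))
    len = length-∈-tuples 0 n as∈
    len′ = length-∈-tuples 0 n as′∈
    eq′ : mul m (P k) (embed (tupleProd m 0 as)) ≡ mul m (P k′) (embed (tupleProd m 0 as′))
    eq′ = trans (sym (split as k len)) (trans eq (split as′ k′ len′))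
    at-last : ∀ k u → lookup (mul m (P k) (embed u)) (Fin.fromℕ n) ≡ lookup (P k) (Fin.fromℕ n)
    at-last k u = trans (lookup-mul (P k) (embed u) (Fin.fromℕ n))
      (trans (cong (act m (P k)) (lookup-embed-last u))
             (cong (β (P k) (Fin.fromℕ n) ,_) (m<n⇒m%n≡m (Reduced-power (σ m n) k (Fin.fromℕ n)))))
    k≡k′ : k ≡ k′
    k≡k′ = power-σ-last-injective n k k′ k< k′<
      (trans (sym (at-last k (tupleProd m 0 as))) (trans (cong (λ v → lookup v (Fin.fromℕ n)) eq′) (at-last k′ (tupleProd m 0 as′))))
    embed-reduced : ∀ as → length as ≡ n → Reduced m (embed (tupleProd m {n} 0 as))
    embed-reduced as len = proj₁ (ins-InG m (tupleProd m 0 as) (Fin.fromℕ n) 0 z<s (tupleProd-InG 0 as (≤-reflexive len)))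
    as≡as′ : as ≡ as′
    as≡as′ = tupleProd-injective n as∈ as′∈ (embed-injective
      (mul-cancelˡ (P k′) (embed (tupleProd m 0 as)) (embed (tupleProd m 0 as′)) (proj₂ (InG-power (σ m n) k′ (σ-InG n ≤-refl)))
                   (embed-reduced as len) (embed-reduced as′ len′)
        (subst (λ k → mul m (P k) (embed (tupleProd m 0 as)) ≡ mul m (P k′) (embed (tupleProd m 0 as′))) k≡k′ eq′)))

  first-match : ∀ {n} (w : Elt n) (g : List (List ℕ) → ℕ) →
    (∀ ks kss → g (ks ∷ kss) ≡ (if ⌊ tupleProd m 0 ks ≟E w ⌋ then sum ks else g kss)) →
    ∀ {kss ks} → ks ∈ kss → (∀ {ks′} → ks′ ∈ kss → tupleProd m 0 ks′ ≡ w → ks′ ≡ ks) → tupleProd m 0 ks ≡ w → g kss ≡ sum ks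
  first-match w g g-∷ {ks′ ∷ kss} {ks} ks∈ unique match rewrite g-∷ ks′ kss with tupleProd m 0 ks′ ≟E w | ks∈
  ... | yes match′ | _         = cong sum (unique (here refl) match′)
  ... | no  ¬match | here refl = ⊥-elim (¬match match)
  ... | no  _      | there ks∈ = first-match w g g-∷ ks∈ (unique ∘ there) match

  -- `fmaj` searches with a function local to its definition; as for `distinctB`, generalising
  -- `tuples m 0 n` by `with` (but not in `tuplesFrom0`) lets unification recover it.
  private
    tuplesFrom0 : ℕ → List (List ℕ)
    tuplesFrom0 n = tuples m 0 n

    Search : ∀ {n} → Elt n → Set
    Search {n} w = Σ (List (List ℕ) → ℕ) λ g →
      (∀ ks kss → g (ks ∷ kss) ≡ (if ⌊ tupleProd m 0 ks ≟E w ⌋ then sum ks else g kss)) × g (tuplesFrom0 n) ≡ fmaj m w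

    search : ∀ {n} (w : Elt n) {g : List (List ℕ) → ℕ} (l : List (List ℕ)) → g l ≡ g l →
      (∀ ks kss → g (ks ∷ kss) ≡ (if ⌊ tupleProd m 0 ks ≟E w ⌋ then sum ks else g kss)) → g (tuplesFrom0 n) ≡ fmaj m w → Search w
    search w {g} _ _ g-∷ g≡fmaj = g , g-∷ , g≡fmaj

    fmaj-search : ∀ {n} (w : Elt n) → Search w
    fmaj-search {n} w with search w {_} | refl {x = fmaj m w}
    ... | mk | fmaj≡fmaj with tuples m 0 n
    ... | l = mk l fmaj≡fmaj (λ _ _ → refl) refl

  fmaj-tupleProd : ∀ n {ks} → ks ∈ tuples m 0 n → fmaj m (tupleProd m {n} 0 ks) ≡ sum ks
  fmaj-tupleProd n {ks} ks∈ with fmaj-search (tupleProd m {n} 0 ks)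
  ... | g , g-∷ , g≡fmaj = trans (sym g≡fmaj) (first-match _ g g-∷ ks∈ (λ ks′∈ eq → tupleProd-injective n ks′∈ ks∈ eq) refl)

  tuples↭snoc : ∀ n → tuples m 0 (suc n) ↭ cartesianProductWith (λ k ks → ks ++ k ∷ []) (upTo (m * n + m)) (tuples m 0 n)
  tuples↭snoc n = Unique-⊆-⊇⇒↭ (Unique-tuples 0 (suc n)) unique sub sup
    where
    unique : Unique (cartesianProductWith (λ k ks → ks ++ k ∷ []) (upTo (m * n + m)) (tuples m 0 n))
    unique = Unique.cartesianProductWith⁺ (λ k ks → ks ++ k ∷ [])
      (λ {k} {k′} {ks} {ks′} eq → swap (∷ʳ-injective ks ks′ eq)) (Unique.upTo⁺ (m * n + m)) (Unique-tuples 0 n)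
    sub : tuples m 0 (suc n) ⊆ cartesianProductWith (λ k ks → ks ++ k ∷ []) (upTo (m * n + m)) (tuples m 0 n)
    sub ks∈ with ∈-tuples-snoc⁻ 0 n ks∈
    ... | ks′ , k , refl , ks′∈ , k< = ∈-cartesianProductWith⁺ (λ k ks → ks ++ k ∷ []) (∈-upTo⁺ k<) ks′∈
    sup : cartesianProductWith (λ k ks → ks ++ k ∷ []) (upTo (m * n + m)) (tuples m 0 n) ⊆ tuples m 0 (suc n)
    sup ks∈ with ∈-cartesianProductWith⁻ (λ k ks → ks ++ k ∷ []) (upTo (m * n + m)) (tuples m 0 n) ks∈
    ... | k , ks′ , k∈ , ks′∈ , refl = ∈-tuples-snoc⁺ 0 n ks′∈ (∈-upTo⁻ k∈)

  sum-↭-sums : ∀ n → map sum (tuples m 0 n) ↭ sums m n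
  sum-↭-sums zero    = ↭-refl
  sum-↭-sums (suc n) = begin
    map sum (tuples m 0 (suc n))
      ↭⟨ ↭.map⁺ sum (tuples↭snoc n) ⟩
    map sum (cartesianProductWith (λ k ks → ks ++ k ∷ []) (upTo (m * n + m)) (tuples m 0 n))
      ≡⟨ map-cartesianProductWith sum (λ k ks → ks ++ k ∷ []) (upTo (m * n + m)) (tuples m 0 n) ⟩
    cartesianProductWith (λ k ks → sum (ks ++ k ∷ [])) (upTo (m * n + m)) (tuples m 0 n)
      ≡⟨ cartesianProductWith-cong (upTo (m * n + m)) (tuples m 0 n) (λ {k} {ks} _ _ → sum-snoc k ks) ⟩
    cartesianProductWith (λ k ks → k + sum ks) (upTo (m * n + m)) (tuples m 0 n)
      ≡⟨ cartesianProductWith-mapʳ _+_ sum (upTo (m * n + m)) (tuples m 0 n) ⟨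
    cartesianProductWith _+_ (upTo (m * n + m)) (map sum (tuples m 0 n))
      ↭⟨ cartesianProductWith-↭ _+_ (↭-refl {x = upTo (m * n + m)}) (sum-↭-sums n) ⟩
    sums m (suc n) ∎
    where
    open PermutationReasoning
    sum-snoc : ∀ k ks → sum (ks ++ k ∷ []) ≡ k + sum ks
    sum-snoc k ks = trans (sum-++ ks (k ∷ [])) (trans (cong (sum ks +_) (+-identityʳ k)) (+-comm (sum ks) k))

  -- Injective on tuples, and there are as many tuples as elements of G(m,1,n).
  tupleProd↭G : ∀ n → map (tupleProd m {n} 0) (tuples m 0 n) ↭ G m n
  tupleProd↭G n = Unique-⊆-length⇒↭ _≟E_
    (Unique-map⁺-∈ (tupleProd m {n} 0) (tupleProd-injective n) (Unique-tuples 0 n)) (Unique-G m n) sub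
    (≤-reflexive (begin
      length (G m n)                                      ≡⟨ length-map (L m) (G m n) ⟨
      length (map (L m) (G m n))                          ≡⟨ ↭.↭-length (L-↭-sums n) ⟩
      length (sums m n)                                   ≡⟨ ↭.↭-length (sum-↭-sums n) ⟨
      length (map sum (tuples m 0 n))                     ≡⟨ length-map sum (tuples m 0 n) ⟩
      length (tuples m 0 n)                               ≡⟨ length-map (tupleProd m 0) (tuples m 0 n) ⟨
      length (map (tupleProd m {n} 0) (tuples m 0 n))     ∎))
    where
    open ≡-Reasoning
    sub : map (tupleProd m {n} 0) (tuples m 0 n) ⊆ G m n
    sub w∈ with ∈-map⁻ (tupleProd m {n} 0) {xs = tuples m 0 n} w∈
    ... | ks , ks∈ , refl = InG⇒∈G _ (tupleProd-InG 0 ks (≤-reflexive (length-∈-tuples 0 n ks∈)))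

  fmaj-↭-sums : ∀ n → map (fmaj m) (G m n) ↭ sums m n
  fmaj-↭-sums n = begin
    map (fmaj m) (G m n)                                  ↭⟨ ↭.map⁺ (fmaj m) (tupleProd↭G n) ⟨
    map (fmaj m) (map (tupleProd m {n} 0) (tuples m 0 n)) ≡⟨ map-∘ (tuples m 0 n) ⟨
    map (fmaj m ∘ tupleProd m {n} 0) (tuples m 0 n)       ≡⟨ map-cong-local (All.tabulate (λ {ks} → fmaj-tupleProd n {ks})) ⟩
    map sum (tuples m 0 n)                                ↭⟨ sum-↭-sums n ⟩
    sums m n                                              ∎
    where open PermutationReasoning

theorem4p12 : (m n : ℕ) → 2 ≤ m → 1 ≤ n → (d : ℕ) →
    (countStat m n (fmaj m) d ≡ countStat m n (L m) d)
    × (countStat m n (L m) d ≡ coeff (prodPoly m n) d)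
-- 2 ≤ m only serves to exclude m = 0.
theorem4p12 (suc K) n _ _ d =
  trans (countStat≡ (fmaj m) fmaj↭sums) (sym (countStat≡ (L m) L↭sums)) ,
  trans (countStat≡ (L m) L↭sums) (count-sums m n d)
  where
  m : ℕ
  m = suc K
  fmaj↭sums : map (fmaj m) (G m n) ↭ sums m n
  fmaj↭sums = FlagMajor.fmaj-↭-sums K n
  L↭sums : map (L m) (G m n) ↭ sums m n
  L↭sums = Length.L-↭-sums K n
  countStat≡ : (f : Elt n → ℕ) → map f (G m n) ↭ sums m n → countStat m n f d ≡ count d (sums m n)
  countStat≡ f f↭sums = trans (count-map f d (G m n)) (count-↭ d f↭sums)
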